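{- For all integers $r\ge1$ and $0\le k\le n$, \[ q^{r\binom{k+1}{2}+(1-r)k}\,[r]_q^{\,k}\,[k]_{q^r}!\,S_r[n,k]=\sum_{\ell=0}^k q^{rk(k-\ell)}\,A^r_{n,\ell}(q)\,{n-\ell\brack k-\ell}_{q^r}. \]
   Context: $[k]_q=1+q+\dots+q^{k-1}$, $[0]_q=0$, $[k]_q!=\prod_{i=1}^k[i]_q$, ${n\brack k}_q=\frac{[n]_q!}{[k]_q![n-k]_q!}$; $[k]_{q^r}!$ and ${n\brack k}_{q^r}$ are these with $q$ replaced by $q^r$. $S_r[n,k]$ is defined by $S_r[0,k]=\delta_{0k}$ and $S_r[n,k]=S_r[n-1,k-1]+[rk+1]_qS_r[n-1,k]$ for $n\ge1$. The colored permutation group $\mathbb{Z}_r\wr\mathfrak{S}_n$ consists of words $\pi=\pi_1^{z_1}\cdots\pi_n^{z_n}$ with $\pi_1\cdots\pi_n$ a permutation of $[n]$ and colors $z_i\in\{0,\dots,r-1\}$ (with $k^0$ written $k$), totally ordered by $n^{r-1}<\dots<n^1<\dots<1^{r-1}<\dots<1^1<0<1<\dots<n$. Set $\pi_0^{z_0}=0$; $\mathrm{Des}_r(\pi)=\{i\in\{0,\dots,n-1\}:\pi_i^{z_i}>\pi_{i+1}^{z_{i+1}}\}$, $\mathrm{des}_r(\pi)=|\mathrm{Des}_r(\pi)|$, $\mathrm{fmaj}_r(\pi)=r\sum_{i\in\mathrm{Des}_r(\pi)}i+\sum_{i=1}^nz_i$, and $A^r_{n,\ell}(q)=\sum_{\pi\in\mathbb{Z}_r\wr\mathfrak{S}_n,\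 \mathrm{des}_r(\pi)=\ell}q^{\mathrm{fmaj}_r(\pi)}$. -}

module Defs where

open import Data.Nat using (ℕ; zero; suc; _+_; _*_; _∸_; _^_; _<ᵇ_; _≡ᵇ_; NonZero)
open import Data.Nat.Properties using (m*n≢0)
open import Data.Nat.DivMod using (_/_)
open import Data.Bool using (Bool; true; false; _∧_; _∨_; not; if_then_else_)
open import Data.List using (List; []; _∷_; map; upTo; concatMap; filter; length)
open import Data.Nat.ListAction using (sum)
open import Data.Bool.ListAction using (any)
open import Data.Product using (_×_; _,_; proj₁; proj₂)
open import Relation.Binary.PropositionalEquality using (_≡_)
open import Relation.Nullary.Decidable using (does)
open import Relation.Unary using (Decidable)

qint : ℕ → ℕ → ℕ
qint q k = sum (map (q ^_) (upTo k))

qfact : ℕ → ℕ → ℕ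
qfact q zero    = 1
qfact q (suc k) = qfact q k * qint q (suc k)

qfact-nonZero : ∀ q k → NonZero (qfact q k)
qfact-nonZero q zero    = _
qfact-nonZero q (suc k) = m*n≢0 (qfact q k) (qint q (suc k)) {{qfact-nonZero q k}} {{_}}

-- q-binomial [n k]_q = [n]_q! / ([k]_q! [n-k]_q!)   (exact division in ℕ)
qbinom : ℕ → ℕ → ℕ → ℕ
qbinom q n k = _/_ (qfact q n) (qfact q k * qfact q (n ∸ k))
  {{m*n≢0 (qfact q k) (qfact q (n ∸ k)) {{qfact-nonZero q k}} {{qfact-nonZero q (n ∸ k)}}}}

S : ℕ → ℕ → ℕ → ℕ → ℕ
S r q zero    zero    = 1
S r q zero    (suc k) = 0
S r q (suc n) zero    = qint q (r * 0 + 1) * S r q n zero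
S r q (suc n) (suc k) = S r q n k + qint q (r * suc k + 1) * S r q n (suc k)

-- A colored letter a^z is a pair (a , z); the letter 0 = π_0 is (0 , 0).
Letter : Set
Letter = ℕ × ℕ

-- strict order on colored letters:
-- n^{r-1} < ... < n^1 < ... < 1^{r-1} < ... < 1^1 < 0 < 1 < ... < n
_>L_ : Letter → Letter → Bool
(a , zero)  >L (b , zero)  = b <ᵇ a
(a , zero)  >L (b , suc w) = true
(a , suc z) >L (b , zero)  = false
(a , suc z) >L (b , suc w) = (a <ᵇ b) ∨ ((a ≡ᵇ b) ∧ (z <ᵇ w))

words : {A : Set} → ℕ → List A → List (List A)
words zero    L = [] ∷ []
words (suc m) L = concatMap (λ a → map (a ∷_) (words m L)) L

distinct : List ℕ → Bool
distinct []       = true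
distinct (x ∷ xs) = not (any (x ≡ᵇ_) xs) ∧ distinct xs

-- the colored permutation group Z_r ≀ S_n: words π_1^{z_1} ... π_n^{z_n}
-- with π_1 ... π_n a permutation of [n] = {1..n} and colors z_i ∈ {0..r-1}
coloredPerms : ℕ → ℕ → List (List Letter)
coloredPerms r n =
  filter (λ w → distinct (map proj₁ w) Data.Bool.≟ true)
    (words n (concatMap (λ a → map (a ,_) (upTo r)) (map suc (upTo n))))
  where import Data.Bool

-- descent positions of 0 π_1 ... π_n, i.e. i ∈ {0..n-1} with π_i > π_{i+1},
-- computed on the word with π_0 = 0 prepended; i is the index of the left letter
descentsFrom : ℕ → Letter → List Letter → List ℕ
descentsFrom i x []       = []
descentsFrom i x (y ∷ ys) =
  (if x >L y then i ∷ descentsFrom (suc i) y ys else descentsFrom (suc i) y ys)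

Des : List Letter → List ℕ
Des π = descentsFrom 0 (0 , 0) π

des : List Letter → ℕ
des π = length (Des π)

fmaj : ℕ → List Letter → ℕ
fmaj r π = r * sum (Des π) + sum (map proj₂ π)

A : ℕ → ℕ → ℕ → ℕ → ℕ
A r n ℓ q = sum (map (λ π → q ^ fmaj r π)
                     (filter (λ π → des π Data.Nat.≟ ℓ) (coloredPerms r n)))
  where import Data.Nat

Σ0to : ℕ → (ℕ → ℕ) → ℕ
Σ0to k f = sum (map f (upTo (suc k)))

-- Put Q = q^r and let T(n,k) = Σ_π q^{fmaj π} Q^{k(k-des π)} [n - des π, k - des π]_Q over
-- π ∈ ℤ_r ≀ 𝔖_n; exchanging the two sums shows that the right-hand side is T(n,k). Every colored
-- permutation of n+1 arises exactly once by inserting the letter n+1, with some color z, into one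
-- of the n+1 gaps of a colored permutation σ of n. Uncolored, n+1 is larger than every letter of
-- σ, and colored it is smaller than every one, so the insertion shifts des and the descent
-- positions of σ in a way that can be summed over the gaps in closed form. With s = q + ... + q^(r-1)
-- and a q-binomial identity this yields
--   T(n+1,k+1) = Q^k (s + Q) [k+1]_Q T(n,k) + ([k+2]_Q + s [k+1]_Q) T(n,k+1),   T(n+1,0) = T(n,0).
-- Since [r(k+1)+1]_q = [k+2]_Q + s [k+1]_Q and the left-hand factor c_k of S_r[n,k] satisfies
-- c_{k+1} = Q^k (s + Q) [k+1]_Q c_k, the left-hand side obeys the same recurrence and initial values.
module Submission where

open import Defs
open import Data.Bool using (Bool; true; false; T; if_then_else_)
import Data.Bool as B
open import Data.Bool.ListAction using (any)
open import Data.Empty using (⊥; ⊥-elim)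
open import Data.List using (List; []; _∷_; map; length; concatMap; _++_; upTo; applyUpTo; filter)
open import Data.List.Properties using (map-∘; map-++; length-map; length-++-sucʳ; length-++-≤ˡ; ∷-injectiveˡ; ∷-injectiveʳ)
open import Data.List.Membership.Propositional using (_∈_; _∉_; lose; find)
open import Data.List.Membership.Propositional.Properties
open import Data.List.Membership.Propositional.Properties.WithK using (unique∧set⇒bag)

open import Data.List.Relation.Binary.BagAndSetEquality using (∼bag⇒↭)
import Data.List.Relation.Binary.Permutation.Propositional.Properties as PermP
open import Data.List.Relation.Unary.All using (All; []; _∷_)
import Data.List.Relation.Unary.All as All
import Data.List.Relation.Unary.All.Properties as AllP
open import Data.List.Relation.Unary.AllPairs using ([]; _∷_)
open import Data.List.Relation.Unary.Any using (here; there)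
open import Data.List.Relation.Unary.Unique.Propositional using (Unique)
import Data.List.Relation.Unary.Unique.Propositional.Properties as UP
open import Data.Nat
open import Data.List.Membership.DecPropositional _≟_ using (_∈?_)
open import Data.Nat.Combinatorics using (_C_; nCk+nC[k+1]≡[n+1]C[k+1]; nC1≡n)
open import Data.Nat.DivMod using (m*n/n≡m)
open import Data.Nat.ListAction using (sum)
open import Data.Nat.ListAction.Properties using (sum-++; sum-↭)
open import Data.Nat.Properties
open import Data.Nat.Tactic.RingSolver
open import Data.Product using (_×_; _,_; proj₁; proj₂; ∃)
open import Data.Product.Properties using (,-injectiveʳ)
open import Data.Sum using (inj₁; inj₂)
open import Data.Unit using (tt)
open import Function using (_∘_)
open import Function.Bundles using (mk⇔)
open import Relation.Binary.Definitions using (tri<; tri≈; tri>)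
open import Relation.Binary.PropositionalEquality
open import Relation.Nullary using (¬_; does; yes; no)
open import Relation.Unary using (Decidable)
open ≡-Reasoning

Unique-concatMap⁺ : ∀ {A B : Set} (f : A → List B) (xs : List A) → Unique xs →
  (∀ {a} → a ∈ xs → Unique (f a)) →
  (∀ {a b w} → a ∈ xs → b ∈ xs → w ∈ f a → w ∈ f b → a ≡ b) →
  Unique (concatMap f xs)
Unique-concatMap⁺ f [] _ _ _ = []
Unique-concatMap⁺ f (x ∷ xs) (x∉ ∷ u) uf dj =
  UP.++⁺ (uf (here refl)) (Unique-concatMap⁺ f xs u (λ m → uf (there m)) (λ m1 m2 → dj (there m1) (there m2))) disj
  where
  disj : ∀ {v} → ¬ (v ∈ f x × v ∈ concatMap f xs)
  disj (v1 , v2) with find (∈-concatMap⁻ f v2)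
  ... | b , b∈ , vb = All.lookup x∉ b∈ (dj (here refl) (there b∈) v1 vb)

Unique-map∈⁺ : ∀ {A B : Set} (f : A → B) (xs : List A) → Unique xs →
  (∀ {a b} → a ∈ xs → b ∈ xs → f a ≡ f b → a ≡ b) → Unique (map f xs)
Unique-map∈⁺ f [] _ _ = []
Unique-map∈⁺ f (x ∷ xs) (x∉ ∷ u) inj = allmap xs x∉ (λ m → m) ∷ Unique-map∈⁺ f xs u (λ m1 m2 → inj (there m1) (there m2))
  where
  allmap : ∀ ys → All (x ≢_) ys → (∀ {b} → b ∈ ys → b ∈ xs) → All (f x ≢_) (map f ys)
  allmap [] _ _ = []
  allmap (y ∷ ys) (ne ∷ a) sub = (λ e → ne (inj (here refl) (there (sub (here refl))) e)) ∷ allmap ys a (λ m → sub (there m))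

sum-map-concatMap : ∀ {A B : Set} (g : B → ℕ) (f : A → List B) xs →
  sum (map g (concatMap f xs)) ≡ sum (map (λ a → sum (map g (f a))) xs)
sum-map-concatMap g f [] = refl
sum-map-concatMap g f (x ∷ xs) = begin
  sum (map g (f x ++ concatMap f xs)) ≡⟨ cong sum (map-++ g (f x) (concatMap f xs)) ⟩
  sum (map g (f x) ++ map g (concatMap f xs)) ≡⟨ sum-++ (map g (f x)) _ ⟩
  sum (map g (f x)) + sum (map g (concatMap f xs)) ≡⟨ cong (sum (map g (f x)) +_) (sum-map-concatMap g f xs) ⟩
  sum (map g (f x)) + sum (map (λ a → sum (map g (f a))) xs) ∎

sum-map-bag : ∀ {A : Set} (g : A → ℕ) (xs ys : List A) → Unique xs → Unique ys →
  (∀ {w} → w ∈ xs → w ∈ ys) → (∀ {w} → w ∈ ys → w ∈ xs) →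
  sum (map g xs) ≡ sum (map g ys)
sum-map-bag g xs ys ux uy to from =
  sum-↭ (PermP.map⁺ g (∼bag⇒↭ (unique∧set⇒bag ux uy (mk⇔ to from))))

sum-map-cong : ∀ {A : Set} (g h : A → ℕ) (xs : List A) → (∀ {a} → a ∈ xs → g a ≡ h a) → sum (map g xs) ≡ sum (map h xs)
sum-map-cong g h [] _ = refl
sum-map-cong g h (x ∷ xs) e = cong₂ _+_ (e (here refl)) (sum-map-cong g h xs (λ m → e (there m)))

Unique-delete : ∀ {A : Set} (xs : List A) {y ys} → Unique (xs ++ y ∷ ys) → Unique (xs ++ ys) × y ∉ (xs ++ ys)
Unique-delete [] (y∉ ∷ u) = u , λ m → All.lookup y∉ m refl
Unique-delete (x ∷ xs) {y} {ys} (x∉ ∷ u) with Unique-delete xs u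
... | u' , y∉ = (drop-all xs x∉ ∷ u') , λ { (here refl) → All.lookup x∉ (∈-++⁺ʳ xs (here refl)) refl ; (there m) → y∉ m }
  where
  drop-all : ∀ zs → All (x ≢_) (zs ++ y ∷ ys) → All (x ≢_) (zs ++ ys)
  drop-all [] (_ ∷ a) = a
  drop-all (z ∷ zs) (p ∷ a) = p ∷ drop-all zs a

All-delete : ∀ {A : Set} {P : A → Set} xs {y ys} → All P (xs ++ y ∷ ys) → All P (xs ++ ys)
All-delete xs p = AllP.++⁺ (AllP.++⁻ˡ xs p) (All.tail (AllP.++⁻ʳ xs p))

InRange : ℕ → ℕ → Set
InRange n a = 0 < a × a ≤ n

All-InRange-pred : ∀ {n} xs → All (InRange (suc n)) xs → suc n ∉ xs → All (InRange n) xs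
All-InRange-pred xs p n∉ = All.zipWith pred-range (p , AllP.¬Any⇒All¬ xs n∉)
  where pred-range : ∀ {n a} → InRange (suc n) a × suc n ≢ a → InRange n a
        pred-range ((0<a , a≤1+n) , 1+n≢a) = 0<a , ≤-pred (≤∧≢⇒< a≤1+n (1+n≢a ∘ sym))

Unique-InRange-length : ∀ n xs → Unique xs → All (InRange n) xs → length xs ≤ n
Unique-InRange-length zero [] _ _ = z≤n
Unique-InRange-length zero (x ∷ xs) _ ((0<x , x≤0) ∷ _) = ⊥-elim (<⇒≱ 0<x x≤0)
Unique-InRange-length (suc n) xs u p with suc n ∈? xs
... | no n∉xs = m≤n⇒m≤1+n (Unique-InRange-length n xs u (All-InRange-pred xs p n∉xs))
... | yes n∈xs with pre , post , refl ← ∈-∃++ n∈xs with u′ , n∉ ← Unique-delete pre u =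
  subst (_≤ suc n) (sym (length-++-sucʳ pre (suc n) post))
    (s≤s (Unique-InRange-length n (pre ++ post) u′ (All-InRange-pred (pre ++ post) (All-delete pre p) n∉)))

sum-map-filter : ∀ {A : Set} {P : A → Set} (P? : Decidable P) (h : A → ℕ) xs →
  sum (map h (filter P? xs)) ≡ sum (map (λ x → if does (P? x) then h x else 0) xs)
sum-map-filter P? h [] = refl
sum-map-filter P? h (x ∷ xs) with does (P? x)
... | true = cong (h x +_) (sum-map-filter P? h xs)
... | false = sum-map-filter P? h xs

sum-map-* : ∀ {A : Set} c e (f : A → ℕ) xs → c * sum (map f xs) * e ≡ sum (map (λ x → c * f x * e) xs)
sum-map-* c e f [] = trans (cong (_* e) (*-zeroʳ c)) refl
sum-map-* c e f (x ∷ xs) = trans (l c e (f x) (sum (map f xs))) (cong (c * f x * e +_) (sum-map-* c e f xs))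
  where l : ∀ c e a b → c * (a + b) * e ≡ c * a * e + c * b * e
        l = solve-∀

sum-map-0 : ∀ {A : Set} (xs : List A) → sum (map (λ _ → 0) xs) ≡ 0
sum-map-0 [] = refl
sum-map-0 (x ∷ xs) = sum-map-0 xs

sum-map-+ : ∀ {A : Set} (f g : A → ℕ) xs → sum (map (λ x → f x + g x) xs) ≡ sum (map f xs) + sum (map g xs)
sum-map-+ f g [] = refl
sum-map-+ f g (x ∷ xs) = trans (cong (f x + g x +_) (sum-map-+ f g xs)) (l (f x) (g x) _ _)
  where l : ∀ a b c d → a + b + (c + d) ≡ a + c + (b + d)
        l = solve-∀

sum-map-swap : ∀ {A : Set} (G : ℕ → A → ℕ) (L : List ℕ) (xs : List A) →
  sum (map (λ ℓ → sum (map (G ℓ) xs)) L) ≡ sum (map (λ x → sum (map (λ ℓ → G ℓ x) L)) xs)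
sum-map-swap G [] xs = sym (sum-map-0 xs)
sum-map-swap G (ℓ ∷ L) xs = trans (cong (sum (map (G ℓ) xs) +_) (sum-map-swap G L xs))
  (sym (sum-map-+ (G ℓ) (λ x → sum (map (λ ℓ → G ℓ x) L)) xs))

sum-map-linear : ∀ {A : Set} (a u v : A → ℕ) c1 c2 (xs : List A) →
  sum (map (λ x → a x * (c1 * u x + c2 * v x)) xs) ≡ c1 * sum (map (λ x → a x * u x) xs) + c2 * sum (map (λ x → a x * v x) xs)
sum-map-linear a u v c1 c2 [] = l c1 c2
  where l : ∀ a b → 0 ≡ a * 0 + b * 0
        l = solve-∀
sum-map-linear a u v c1 c2 (x ∷ xs) = trans (cong (a x * (c1 * u x + c2 * v x) +_) (sum-map-linear a u v c1 c2 xs)) (l (a x) (u x) (v x) c1 c2 _ _)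
  where l : ∀ a u v c1 c2 U V → a * (c1 * u + c2 * v) + (c1 * U + c2 * V) ≡ c1 * (a * u + U) + c2 * (a * v + V)
        l = solve-∀

Σ< : ℕ → (ℕ → ℕ) → ℕ
Σ< zero f = 0
Σ< (suc m) f = f 0 + Σ< m (f ∘ suc)

sum-applyUpTo : ∀ (f g : ℕ → ℕ) m → sum (map f (applyUpTo g m)) ≡ Σ< m (f ∘ g)
sum-applyUpTo f g zero = refl
sum-applyUpTo f g (suc m) = cong (f (g 0) +_) (sum-applyUpTo f (g ∘ suc) m)

sum-upTo : ∀ (f : ℕ → ℕ) m → sum (map f (upTo m)) ≡ Σ< m f
sum-upTo f m = sum-applyUpTo f (λ x → x) m

Σ<-cong : ∀ m {f g : ℕ → ℕ} → (∀ i → f i ≡ g i) → Σ< m f ≡ Σ< m g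
Σ<-cong zero h = refl
Σ<-cong (suc m) h = cong₂ _+_ (h 0) (Σ<-cong m (h ∘ suc))

Σ<-*ˡ : ∀ m c (f : ℕ → ℕ) → Σ< m (λ i → c * f i) ≡ c * Σ< m f
Σ<-*ˡ zero c f = sym (*-zeroʳ c)
Σ<-*ˡ (suc m) c f = trans (cong (c * f 0 +_) (Σ<-*ˡ m c (f ∘ suc))) (sym (*-distribˡ-+ c (f 0) _))

qint-Σ : ∀ q k → qint q k ≡ Σ< k (q ^_)
qint-Σ q k = sum-upTo (q ^_) k

qint-suc : ∀ q k → qint q (suc k) ≡ 1 + q * qint q k
qint-suc q k = begin
  qint q (suc k) ≡⟨ qint-Σ q (suc k) ⟩
  1 + Σ< k (λ i → q * q ^ i) ≡⟨ cong (1 +_) (Σ<-*ˡ k q (q ^_)) ⟩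
  1 + q * Σ< k (q ^_) ≡⟨ cong (λ x → 1 + q * x) (sym (qint-Σ q k)) ⟩
  1 + q * qint q k ∎

qint-+ : ∀ q a b → qint q (a + b) ≡ qint q a + q ^ a * qint q b
qint-+ q zero b = sym (trans (cong (qint q 0 +_) (*-identityˡ (qint q b))) refl)
qint-+ q (suc a) b = begin
  qint q (suc (a + b)) ≡⟨ qint-suc q (a + b) ⟩
  1 + q * qint q (a + b) ≡⟨ cong (λ x → 1 + q * x) (qint-+ q a b) ⟩
  1 + q * (qint q a + q ^ a * qint q b) ≡⟨ lem q (q ^ a) (qint q a) (qint q b) ⟩
  (1 + q * qint q a) + q * q ^ a * qint q b ≡⟨ cong (_+ q * q ^ a * qint q b) (sym (qint-suc q a)) ⟩
  qint q (suc a) + q ^ suc a * qint q b ∎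
  where lem : ∀ q x y z → 1 + q * (y + x * z) ≡ (1 + q * y) + q * x * z
        lem = solve-∀

qint-sucʳ : ∀ q k → qint q (suc k) ≡ qint q k + q ^ k
qint-sucʳ q k = begin
  qint q (suc k) ≡⟨ cong (qint q) (+-comm 1 k) ⟩
  qint q (k + 1) ≡⟨ qint-+ q k 1 ⟩
  qint q k + q ^ k * 1 ≡⟨ cong (qint q k +_) (*-identityʳ _) ⟩
  qint q k + q ^ k ∎

qint-* : ∀ q r k → qint q (r * k) ≡ qint q r * qint (q ^ r) k
qint-* q r zero = trans (cong (qint q) (*-zeroʳ r)) (sym (*-zeroʳ (qint q r)))
qint-* q r (suc k) = begin
  qint q (r * suc k) ≡⟨ cong (qint q) (*-suc r k) ⟩
  qint q (r + r * k) ≡⟨ qint-+ q r (r * k) ⟩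
  qint q r + q ^ r * qint q (r * k) ≡⟨ cong (λ x → qint q r + q ^ r * x) (qint-* q r k) ⟩
  qint q r + q ^ r * (qint q r * qint (q ^ r) k) ≡⟨ lem (qint q r) (q ^ r) (qint (q ^ r) k) ⟩
  qint q r * (1 + q ^ r * qint (q ^ r) k) ≡⟨ cong (qint q r *_) (sym (qint-suc (q ^ r) k)) ⟩
  qint q r * qint (q ^ r) (suc k) ∎
  where lem : ∀ a Q b → a + Q * (a * b) ≡ a * (1 + Q * b)
        lem = solve-∀

qint-suc-nonZero : ∀ Q k → NonZero (qint Q (suc k))
qint-suc-nonZero Q k rewrite qint-suc Q k = _

-- qbinom is an exact quotient in ℕ; the proofs compute with the q-Pascal recursion instead.
qchoose : ℕ → ℕ → ℕ → ℕ
qchoose Q a zero = 1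
qchoose Q zero (suc b) = 0
qchoose Q (suc a) (suc b) = qchoose Q a b + Q ^ suc b * qchoose Q a (suc b)

qchoose-< : ∀ Q a b → a < b → qchoose Q a b ≡ 0
qchoose-< Q zero (suc b) _ = refl
qchoose-< Q (suc a) (suc b) (s≤s a<b) =
  trans (cong₂ (λ x y → x + Q ^ suc b * y) (qchoose-< Q a b a<b) (qchoose-< Q a (suc b) (m<n⇒m<1+n a<b)))
        (*-zeroʳ (Q ^ suc b))

qchoose*qfacts : ∀ Q a b → b ≤ a → qchoose Q a b * (qfact Q b * qfact Q (a ∸ b)) ≡ qfact Q a
qchoose*qfacts Q a zero _ = trans (+-identityʳ _) (+-identityʳ _)
qchoose*qfacts Q (suc a) (suc b) (s≤s b≤a) with m≤n⇒m<n∨m≡n b≤a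
... | inj₂ refl = begin
  (qchoose Q b b + Q ^ suc b * qchoose Q b (suc b)) * (qfact Q b * qint Q (suc b) * qfact Q (b ∸ b))
     ≡⟨ cong (λ x → (qchoose Q b b + Q ^ suc b * x) * (qfact Q b * qint Q (suc b) * qfact Q (b ∸ b))) (qchoose-< Q b (suc b) ≤-refl) ⟩
  (qchoose Q b b + Q ^ suc b * 0) * (qfact Q b * qint Q (suc b) * qfact Q (b ∸ b))
     ≡⟨ lem (qchoose Q b b) (qfact Q b) (qint Q (suc b)) (qfact Q (b ∸ b)) (Q ^ suc b) ⟩
  qchoose Q b b * (qfact Q b * qfact Q (b ∸ b)) * qint Q (suc b)
     ≡⟨ cong (_* qint Q (suc b)) (qchoose*qfacts Q b b ≤-refl) ⟩
  qfact Q b * qint Q (suc b) ∎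
  where lem : ∀ x f g h c → (x + c * 0) * (f * g * h) ≡ x * (f * h) * g
        lem = solve-∀
... | inj₁ b<a = begin
  (X + Qb * Y) * (F * g * qfact Q (a ∸ b))
     ≡⟨ cong (λ t → (X + Qb * Y) * (F * g * t)) e2 ⟩
  (X + Qb * Y) * (F * g * (H * h))
     ≡⟨ lem X Y F g H h Qb ⟩
  g * (X * (F * (H * h))) + Qb * h * (Y * (F * g * H))
     ≡⟨ cong₂ (λ u v → g * u + Qb * h * v) (trans (cong (λ t → X * (F * t)) (sym e2)) (qchoose*qfacts Q a b b≤a))
              (qchoose*qfacts Q a (suc b) b<a) ⟩
  g * qfact Q a + Qb * h * qfact Q a
     ≡⟨ lem2 g (qfact Q a) Qb h ⟩
  qfact Q a * (g + Qb * h)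
     ≡⟨ cong (qfact Q a *_) (sym (trans (cong (qint Q) e3) (qint-+ Q (suc b) (a ∸ b)))) ⟩
  qfact Q a * qint Q (suc a) ∎
  where
  X = qchoose Q a b
  Y = qchoose Q a (suc b)
  F = qfact Q b
  g = qint Q (suc b)
  H = qfact Q (a ∸ suc b)
  h = qint Q (a ∸ b)
  Qb = Q ^ suc b
  e1 : a ∸ b ≡ suc (a ∸ suc b)
  e1 = +-∸-assoc 1 b<a
  e2 : qfact Q (a ∸ b) ≡ H * h
  e2 = trans (cong (qfact Q) e1) (cong (H *_) (cong (qint Q) (sym e1)))
  e3 : suc a ≡ suc b + (a ∸ b)
  e3 = cong suc (sym (m+[n∸m]≡n b≤a))
  lem : ∀ X Y F g H h Qb → (X + Qb * Y) * (F * g * (H * h)) ≡ g * (X * (F * (H * h))) + Qb * h * (Y * (F * g * H))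
  lem = solve-∀
  lem2 : ∀ g f Qb h → g * f + Qb * h * f ≡ f * (g + Qb * h)
  lem2 = solve-∀

qbinom≡qchoose : ∀ Q a b → b ≤ a → qbinom Q a b ≡ qchoose Q a b
qbinom≡qchoose Q a b b≤a = begin
  qbinom Q a b ≡⟨ cong (λ x → _/_ x (qfact Q b * qfact Q (a ∸ b)) {{nz}}) (sym (qchoose*qfacts Q a b b≤a)) ⟩
  _/_ (qchoose Q a b * (qfact Q b * qfact Q (a ∸ b))) (qfact Q b * qfact Q (a ∸ b)) {{nz}}
     ≡⟨ m*n/n≡m (qchoose Q a b) (qfact Q b * qfact Q (a ∸ b)) {{nz}} ⟩
  qchoose Q a b ∎
  where nz = m*n≢0 (qfact Q b) (qfact Q (a ∸ b)) {{qfact-nonZero Q b}} {{qfact-nonZero Q (a ∸ b)}}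

qchoose-absorb-suc : ∀ Q N J → qint Q (suc J) * qchoose Q (suc N) (suc J) ≡ qint Q (suc N) * qchoose Q N J
qchoose-absorb-suc Q N J with J ≤? N
... | no J≰N = trans (cong (qint Q (suc J) *_) (qchoose-< Q (suc N) (suc J) (s≤s (≰⇒> J≰N))))
                (trans (*-zeroʳ (qint Q (suc J))) (sym (trans (cong (qint Q (suc N) *_) (qchoose-< Q N J (≰⇒> J≰N))) (*-zeroʳ (qint Q (suc N))))))
... | yes J≤N = *-cancelʳ-≡ _ _ (qfact Q J * qfact Q (N ∸ J)) {{nz}} (begin
  qint Q (suc J) * qchoose Q (suc N) (suc J) * (qfact Q J * qfact Q (N ∸ J))
    ≡⟨ lem (qint Q (suc J)) (qchoose Q (suc N) (suc J)) (qfact Q J) (qfact Q (N ∸ J)) ⟩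
  qchoose Q (suc N) (suc J) * (qfact Q J * qint Q (suc J) * qfact Q (N ∸ J))
    ≡⟨ qchoose*qfacts Q (suc N) (suc J) (s≤s J≤N) ⟩
  qfact Q N * qint Q (suc N)
    ≡⟨ cong (_* qint Q (suc N)) (sym (qchoose*qfacts Q N J J≤N)) ⟩
  qchoose Q N J * (qfact Q J * qfact Q (N ∸ J)) * qint Q (suc N)
    ≡⟨ lem2 (qchoose Q N J) (qfact Q J * qfact Q (N ∸ J)) (qint Q (suc N)) ⟩
  qint Q (suc N) * qchoose Q N J * (qfact Q J * qfact Q (N ∸ J)) ∎)
  where
  nz = m*n≢0 (qfact Q J) (qfact Q (N ∸ J)) {{qfact-nonZero Q J}} {{qfact-nonZero Q (N ∸ J)}}
  lem : ∀ a b c d → a * b * (c * d) ≡ b * (c * a * d)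
  lem = solve-∀
  lem2 : ∀ a b c → a * b * c ≡ c * a * b
  lem2 = solve-∀

qchoose-absorb : ∀ Q N J → qint Q (suc J) * qchoose Q N (suc J) ≡ qint Q (N ∸ J) * qchoose Q N J
qchoose-absorb Q N J with suc J ≤? N
... | yes sJ≤N = *-cancelʳ-≡ _ _ (qfact Q J * H) {{nz}} (begin
  qint Q (suc J) * qchoose Q N (suc J) * (qfact Q J * H)
    ≡⟨ lem (qint Q (suc J)) (qchoose Q N (suc J)) (qfact Q J) H ⟩
  qchoose Q N (suc J) * (qfact Q J * qint Q (suc J) * H)
    ≡⟨ qchoose*qfacts Q N (suc J) sJ≤N ⟩
  qfact Q N
    ≡⟨ sym (qchoose*qfacts Q N J (≤-trans (n≤1+n J) sJ≤N)) ⟩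
  qchoose Q N J * (qfact Q J * qfact Q (N ∸ J))
    ≡⟨ cong (λ t → qchoose Q N J * (qfact Q J * t)) e2 ⟩
  qchoose Q N J * (qfact Q J * (H * qint Q (N ∸ J)))
    ≡⟨ lem2 (qchoose Q N J) (qfact Q J) H (qint Q (N ∸ J)) ⟩
  qint Q (N ∸ J) * qchoose Q N J * (qfact Q J * H) ∎)
  where
  H = qfact Q (N ∸ suc J)
  nz = m*n≢0 (qfact Q J) H {{qfact-nonZero Q J}} {{qfact-nonZero Q (N ∸ suc J)}}
  e1 : N ∸ J ≡ suc (N ∸ suc J)
  e1 = trans (cong (_∸ J) (sym (m+[n∸m]≡n sJ≤N))) (m+n∸m≡n' J (N ∸ suc J))
    where m+n∸m≡n' : ∀ a b → suc a + b ∸ a ≡ suc b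
          m+n∸m≡n' zero b = refl
          m+n∸m≡n' (suc a) b = m+n∸m≡n' a b
  e2 : qfact Q (N ∸ J) ≡ H * qint Q (N ∸ J)
  e2 = trans (cong (qfact Q) e1) (cong (H *_) (cong (qint Q) (sym e1)))
  lem : ∀ a b c d → a * b * (c * d) ≡ b * (c * a * d)
  lem = solve-∀
  lem2 : ∀ a b c d → a * (b * (c * d)) ≡ d * a * (b * c)
  lem2 = solve-∀
... | no sJ≰N with J ≟ N
...   | yes refl = trans (cong (qint Q (suc J) *_) (qchoose-< Q J (suc J) ≤-refl))
                    (trans (*-zeroʳ (qint Q (suc J))) (cong (λ t → qint Q t * qchoose Q J J) (sym (n∸n≡0 J))))
...   | no J≢N = trans (cong (qint Q (suc J) *_) (qchoose-< Q N (suc J) (m<n⇒m<1+n J>N)))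
                (trans (*-zeroʳ (qint Q (suc J))) (sym (trans (cong (qint Q (N ∸ J) *_) (qchoose-< Q N J J>N)) (*-zeroʳ (qint Q (N ∸ J))))))
  where J>N : N < J
        J>N = ≤∧≢⇒< (≤-pred (≰⇒> sJ≰N)) (λ e → J≢N (sym e))

-- Over ℕ the three relations cannot be substituted, so a multiple of each relation is added to
-- both sides, turning the goal into a free semiring identity.
weight-identity : ∀ Q s bd D bj Y bM bN →
  Q * bN + 1 ≡ bj + Y * bM → Q * bj + 1 ≡ bj + Y → Y * bd + bj ≡ bd + D * bj →
  (bd + D + s * bd) * D * Y * (bj + Y * bM) + (Q * D * bN + s * D * (bj + Y * bM)) * bj
  ≡ D * (s + Q) * (bd + D * bj) * bj + (bd + D * bj + D * Y + s * (bd + D * bj)) * D * Y * bM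
weight-identity Q s bd D bj Y bM bN h₁ h₂ h₃ =
  +-cancelʳ-≡ (pad (bd + D * bj) (Y * bd + bj) (bj + Y * bM) (Q * bj + 1)) _ _ (begin
    L + pad (bd + D * bj) (Y * bd + bj) (bj + Y * bM) (Q * bj + 1)
      ≡⟨ free Q s bd D bj Y bM bN ⟩
    R + pad (Y * bd + bj) (bd + D * bj) (Q * bN + 1) (bj + Y)
      ≡⟨ cong (R +_) (pad-cong h₃ (sym h₃) h₁ (sym h₂)) ⟩
    R + pad (bd + D * bj) (Y * bd + bj) (bj + Y * bM) (Q * bj + 1) ∎)
  where
  L = (bd + D + s * bd) * D * Y * (bj + Y * bM) + (Q * D * bN + s * D * (bj + Y * bM)) * bj
  R = D * (s + Q) * (bd + D * bj) * bj + (bd + D * bj + D * Y + s * (bd + D * bj)) * D * Y * bM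
  pad : ℕ → ℕ → ℕ → ℕ → ℕ
  pad u v w x = (D * Y * bM + D * bj + s * (D * Y * bM + D * bj)) * u + D * v + D * bj * w + (D * bd + D * D * bj) * x
  pad-cong : ∀ {u u′ v v′ w w′ x x′} → u ≡ u′ → v ≡ v′ → w ≡ w′ → x ≡ x′ → pad u v w x ≡ pad u′ v′ w′ x′
  pad-cong refl refl refl refl = refl
  free : ∀ Q s bd D bj Y bM bN →
    (bd + D + s * bd) * D * Y * (bj + Y * bM) + (Q * D * bN + s * D * (bj + Y * bM)) * bj
      + ((D * Y * bM + D * bj + s * (D * Y * bM + D * bj)) * (bd + D * bj) + D * (Y * bd + bj)
         + D * bj * (bj + Y * bM) + (D * bd + D * D * bj) * (Q * bj + 1))
    ≡ D * (s + Q) * (bd + D * bj) * bj + (bd + D * bj + D * Y + s * (bd + D * bj)) * D * Y * bM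
      + ((D * Y * bM + D * bj + s * (D * Y * bM + D * bj)) * (Y * bd + bj) + D * (bd + D * bj)
         + D * bj * (Q * bN + 1) + (D * bd + D * D * bj) * (bj + Y))
  free = solve-∀

-- The coefficient Q^{k(k-d)} [n-d, k-d]_Q attached in T(n,k) to a permutation with d descents.
weight : ℕ → ℕ → ℕ → ℕ → ℕ
weight Q n k d = if d ≤ᵇ k then Q ^ (k * (k ∸ d)) * qchoose Q (n ∸ d) (k ∸ d) else 0

weight-d>k : ∀ Q n k d → k < d → weight Q n k d ≡ 0
weight-d>k Q n k d k<d with d ≤ᵇ k in eq
... | false = refl
... | true = ⊥-elim (<⇒≱ k<d (≤ᵇ⇒≤ d k (subst T (sym eq) tt)))

weight-≤ : ∀ Q n k d → d ≤ k → weight Q n k d ≡ Q ^ (k * (k ∸ d)) * qchoose Q (n ∸ d) (k ∸ d)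
weight-≤ Q n k d d≤k with d ≤ᵇ k in eq
... | true = refl
... | false = ⊥-elim (subst T eq (≤⇒≤ᵇ d≤k))

weight-offset : ∀ Q d N j → weight Q (d + N) (d + j) d ≡ Q ^ ((d + j) * j) * qchoose Q N j
weight-offset Q d N j = trans (weight-≤ Q (d + N) (d + j) d (m≤m+n d j))
  (cong₂ (λ x y → Q ^ ((d + j) * x) * qchoose Q y x) (m+n∸m≡n d j) (m+n∸m≡n d N))

weight-identity-scaled : ∀ Q s bd D bj Y bM bN P BB X1 X2 T1 T2 .{{_ : NonZero bj}} →
  bj * X1 ≡ (bj + Y * bM) * BB → bj * X2 ≡ bM * BB → T1 * T2 ≡ P * D →
  (bd + D + s * bd) * D * Y * (bj + Y * bM) + (Q * D * bN + s * D * (bj + Y * bM)) * bj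
    ≡ D * (s + Q) * (bd + D * bj) * bj + (bd + D * bj + D * Y + s * (bd + D * bj)) * D * Y * bM →
  (bd + D + s * bd) * (P * (D * Y) * X1) + (Q * D * bN + s * (D * (bj + Y * bM))) * (P * BB)
  ≡ T1 * (s + Q) * (bd + D * bj) * (T2 * BB) + (bd + D * bj + D * Y + s * (bd + D * bj)) * (P * (D * Y) * X2)
weight-identity-scaled Q s bd D bj Y bM bN P BB X1 X2 T1 T2 ha hb hT hc = *-cancelˡ-≡ _ _ bj (begin
  bj * ((bd + D + s * bd) * (P * (D * Y) * X1) + (Q * D * bN + s * (D * (bj + Y * bM))) * (P * BB))
    ≡⟨ s1 Q s bd D bj Y bM bN P BB X1 ⟩
  (bd + D + s * bd) * (P * (D * Y)) * (bj * X1) + (Q * D * bN + s * (D * (bj + Y * bM))) * (P * BB) * bj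
    ≡⟨ cong (λ u → (bd + D + s * bd) * (P * (D * Y)) * u + (Q * D * bN + s * (D * (bj + Y * bM))) * (P * BB) * bj) ha ⟩
  (bd + D + s * bd) * (P * (D * Y)) * ((bj + Y * bM) * BB) + (Q * D * bN + s * (D * (bj + Y * bM))) * (P * BB) * bj
    ≡⟨ s2 Q s bd D bj Y bM bN P BB ⟩
  P * BB * ((bd + D + s * bd) * D * Y * (bj + Y * bM) + (Q * D * bN + s * D * (bj + Y * bM)) * bj)
    ≡⟨ cong (P * BB *_) hc ⟩
  P * BB * (D * (s + Q) * (bd + D * bj) * bj + (bd + D * bj + D * Y + s * (bd + D * bj)) * D * Y * bM)
    ≡⟨ s3 Q s bd D bj Y bM P BB ⟩
  (P * D) * (s + Q) * (bd + D * bj) * BB * bj + (bd + D * bj + D * Y + s * (bd + D * bj)) * (P * (D * Y)) * (bM * BB)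
    ≡⟨ cong₂ (λ u v → u * (s + Q) * (bd + D * bj) * BB * bj + (bd + D * bj + D * Y + s * (bd + D * bj)) * (P * (D * Y)) * v) (sym hT) (sym hb) ⟩
  (T1 * T2) * (s + Q) * (bd + D * bj) * BB * bj + (bd + D * bj + D * Y + s * (bd + D * bj)) * (P * (D * Y)) * (bj * X2)
    ≡⟨ s4 Q s bd D bj Y P BB X2 T1 T2 ⟩
  bj * (T1 * (s + Q) * (bd + D * bj) * (T2 * BB) + (bd + D * bj + D * Y + s * (bd + D * bj)) * (P * (D * Y) * X2)) ∎)
  where
  s1 : ∀ Q s bd D bj Y bM bN P BB X1 → bj * ((bd + D + s * bd) * (P * (D * Y) * X1) + (Q * D * bN + s * (D * (bj + Y * bM))) * (P * BB))
       ≡ (bd + D + s * bd) * (P * (D * Y)) * (bj * X1) + (Q * D * bN + s * (D * (bj + Y * bM))) * (P * BB) * bj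
  s1 = solve-∀
  s2 : ∀ Q s bd D bj Y bM bN P BB → (bd + D + s * bd) * (P * (D * Y)) * ((bj + Y * bM) * BB) + (Q * D * bN + s * (D * (bj + Y * bM))) * (P * BB) * bj
       ≡ P * BB * ((bd + D + s * bd) * D * Y * (bj + Y * bM) + (Q * D * bN + s * D * (bj + Y * bM)) * bj)
  s2 = solve-∀
  s3 : ∀ Q s bd D bj Y bM P BB → P * BB * (D * (s + Q) * (bd + D * bj) * bj + (bd + D * bj + D * Y + s * (bd + D * bj)) * D * Y * bM)
       ≡ (P * D) * (s + Q) * (bd + D * bj) * BB * bj + (bd + D * bj + D * Y + s * (bd + D * bj)) * (P * (D * Y)) * (bM * BB)
  s3 = solve-∀
  s4 : ∀ Q s bd D bj Y P BB X2 T1 T2 → (T1 * T2) * (s + Q) * (bd + D * bj) * BB * bj + (bd + D * bj + D * Y + s * (bd + D * bj)) * (P * (D * Y)) * (bj * X2)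
       ≡ bj * (T1 * (s + Q) * (bd + D * bj) * (T2 * BB) + (bd + D * bj + D * Y + s * (bd + D * bj)) * (P * (D * Y) * X2))
  s4 = solve-∀

pow-split-suc : ∀ Q d J → Q ^ ((d + suc J) * suc J) ≡ Q ^ ((suc d + J) * J) * (Q ^ d * Q ^ suc J)
pow-split-suc Q d J = begin
  Q ^ ((d + suc J) * suc J) ≡⟨ cong (Q ^_) (e d J) ⟩
  Q ^ ((suc d + J) * J + (d + suc J)) ≡⟨ ^-distribˡ-+-* Q ((suc d + J) * J) (d + suc J) ⟩
  Q ^ ((suc d + J) * J) * Q ^ (d + suc J) ≡⟨ cong (Q ^ ((suc d + J) * J) *_) (^-distribˡ-+-* Q d (suc J)) ⟩
  Q ^ ((suc d + J) * J) * (Q ^ d * Q ^ suc J) ∎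
  where e : ∀ d J → (d + suc J) * suc J ≡ (suc d + J) * J + (d + suc J)
        e = solve-∀

pow-split : ∀ Q d J → Q ^ (d + J) * Q ^ ((d + J) * J) ≡ Q ^ ((suc d + J) * J) * Q ^ d
pow-split Q d J = begin
  Q ^ (d + J) * Q ^ ((d + J) * J) ≡⟨ sym (^-distribˡ-+-* Q (d + J) _) ⟩
  Q ^ (d + J + (d + J) * J) ≡⟨ cong (Q ^_) (e d J) ⟩
  Q ^ ((suc d + J) * J + d) ≡⟨ ^-distribˡ-+-* Q ((suc d + J) * J) d ⟩
  Q ^ ((suc d + J) * J) * Q ^ d ∎
  where e : ∀ d J → d + J + (d + J) * J ≡ (suc d + J) * J + d
        e = solve-∀

weight-offset-suc : ∀ Q d N J →
  weight Q (d + N) (suc (d + J)) d ≡ Q ^ ((suc d + J) * J) * (Q ^ d * Q ^ suc J) * qchoose Q N (suc J)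
weight-offset-suc Q d N J = begin
  weight Q (d + N) (suc (d + J)) d         ≡⟨ cong (λ k → weight Q (d + N) k d) (+-suc d J) ⟨
  weight Q (d + N) (d + suc J) d           ≡⟨ weight-offset Q d N (suc J) ⟩
  Q ^ ((d + suc J) * suc J) * qchoose Q N (suc J)
    ≡⟨ cong (_* qchoose Q N (suc J)) (pow-split-suc Q d J) ⟩
  Q ^ ((suc d + J) * J) * (Q ^ d * Q ^ suc J) * qchoose Q N (suc J) ∎

weight-recurrence-k≤n : ∀ Q s d J M →
  (qint Q (suc d) + s * qint Q d) * weight Q (suc (d + (J + M))) (suc (d + J)) d
  + (Q ^ suc d * qint Q (J + M) + s * (Q ^ d * qint Q (suc (J + M)))) * weight Q (suc (d + (J + M))) (suc (d + J)) (suc d)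
  ≡ Q ^ (d + J) * (s + Q) * qint Q (suc (d + J)) * weight Q (d + (J + M)) (d + J) d
  + (qint Q (suc (suc (d + J))) + s * qint Q (suc (d + J))) * weight Q (d + (J + M)) (suc (d + J)) d
weight-recurrence-k≤n Q s d J M = begin
  (qint Q (suc d) + s * bd) * weight Q (suc (d + N)) (suc (d + J)) d
  + (Q ^ suc d * bN + s * (D * qint Q (suc N))) * weight Q (suc (d + N)) (suc (d + J)) (suc d)
    ≡⟨ cong₂ (λ u v → (u + s * bd) * weight Q (suc (d + N)) (suc (d + J)) d + (Q ^ suc d * bN + s * (D * v)) * weight Q (suc (d + N)) (suc (d + J)) (suc d))
         (qint-sucʳ Q d) eN1 ⟩
  (bd + D + s * bd) * weight Q (suc (d + N)) (suc (d + J)) d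
  + (Q * D * bN + s * (D * (bj + Y * bM))) * weight Q (suc (d + N)) (suc (d + J)) (suc d)
    ≡⟨ cong₂ (λ u v → (bd + D + s * bd) * u + (Q * D * bN + s * (D * (bj + Y * bM))) * v) w1 w2 ⟩
  (bd + D + s * bd) * (P * (D * Y) * X1) + (Q * D * bN + s * (D * (bj + Y * bM))) * (P * BB)
    ≡⟨ weight-identity-scaled Q s bd D bj Y bM bN P BB X1 X2 T1 T2 {{qint-suc-nonZero Q J}} ha hb (pow-split Q d J)
         (weight-identity Q s bd D bj Y bM bN h1 h2 h3) ⟩
  T1 * (s + Q) * (bd + D * bj) * (T2 * BB) + (bd + D * bj + D * Y + s * (bd + D * bj)) * (P * (D * Y) * X2)
    ≡⟨ sym (cong₂ (λ u v → T1 * (s + Q) * u * (T2 * BB) + (v + s * u) * (P * (D * Y) * X2)) b2 b3) ⟩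
  T1 * (s + Q) * qint Q (suc (d + J)) * (T2 * BB)
  + (qint Q (suc (suc (d + J))) + s * qint Q (suc (d + J))) * (P * (D * Y) * X2)
    ≡⟨ sym (cong₂ (λ u v → T1 * (s + Q) * qint Q (suc (d + J)) * u + (qint Q (suc (suc (d + J))) + s * qint Q (suc (d + J))) * v) w3 w4) ⟩
  T1 * (s + Q) * qint Q (suc (d + J)) * weight Q (d + N) (d + J) d
  + (qint Q (suc (suc (d + J))) + s * qint Q (suc (d + J))) * weight Q (d + N) (suc (d + J)) d ∎
  where
  N = J + M
  bd = qint Q d
  D = Q ^ d
  bj = qint Q (suc J)
  Y = Q ^ suc J
  bM = qint Q M
  bN = qint Q N
  P = Q ^ ((suc d + J) * J)
  BB = qchoose Q N J
  X1 = qchoose Q (suc N) (suc J)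
  X2 = qchoose Q N (suc J)
  T1 = Q ^ (d + J)
  T2 = Q ^ ((d + J) * J)
  eN1 : qint Q (suc N) ≡ bj + Y * bM
  eN1 = qint-+ Q (suc J) M
  h1 : Q * bN + 1 ≡ bj + Y * bM
  h1 = trans (+-comm (Q * bN) 1) (trans (sym (qint-suc Q N)) eN1)
  h2 : Q * bj + 1 ≡ bj + Y
  h2 = trans (+-comm (Q * bj) 1) (trans (sym (qint-suc Q (suc J))) (qint-sucʳ Q (suc J)))
  h3 : Y * bd + bj ≡ bd + D * bj
  h3 = trans (+-comm (Y * bd) bj) (trans (sym (qint-+ Q (suc J) d)) (trans (cong (qint Q) (+-comm (suc J) d)) (qint-+ Q d (suc J))))
  ha : bj * X1 ≡ (bj + Y * bM) * BB
  ha = trans (qchoose-absorb-suc Q N J) (cong (_* BB) eN1)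
  hb : bj * X2 ≡ bM * BB
  hb = trans (qchoose-absorb Q N J) (cong (λ t → qint Q t * BB) (m+n∸m≡n J M))
  w1 : weight Q (suc (d + N)) (suc (d + J)) d ≡ P * (D * Y) * X1
  w1 = trans (cong (λ u → weight Q u (suc (d + J)) d) (sym (+-suc d N))) (weight-offset-suc Q d (suc N) J)
  w2 : weight Q (suc (d + N)) (suc (d + J)) (suc d) ≡ P * BB
  w2 = weight-offset Q (suc d) N J
  w3 : weight Q (d + N) (d + J) d ≡ T2 * BB
  w3 = weight-offset Q d N J
  w4 : weight Q (d + N) (suc (d + J)) d ≡ P * (D * Y) * X2
  w4 = weight-offset-suc Q d N J
  b2 : qint Q (suc (d + J)) ≡ bd + D * bj
  b2 = trans (cong (qint Q) (sym (+-suc d J))) (qint-+ Q d (suc J))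
  b3 : qint Q (suc (suc (d + J))) ≡ bd + D * bj + D * Y
  b3 = trans (qint-sucʳ Q (suc (d + J))) (cong₂ _+_ b2 (trans (cong (Q ^_) (sym (+-suc d J))) (^-distribˡ-+-* Q d (suc J))))

weight-k>n : ∀ Q n k d → d ≤ n → n < k → weight Q n k d ≡ 0
weight-k>n Q n k d d≤n n<k = trans (weight-≤ Q n k d (≤-trans d≤n (<⇒≤ n<k)))
  (trans (cong (Q ^ (k * (k ∸ d)) *_) (qchoose-< Q (n ∸ d) (k ∸ d) (∸-monoˡ-< n<k d≤n))) (*-zeroʳ (Q ^ (k * (k ∸ d)))))

weight-diag : ∀ Q n d → weight Q n d d ≡ 1
weight-diag Q n d = begin
  weight Q n d d                                ≡⟨ weight-≤ Q n d d ≤-refl ⟩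
  Q ^ (d * (d ∸ d)) * qchoose Q (n ∸ d) (d ∸ d) ≡⟨ cong (λ e → Q ^ (d * e) * qchoose Q (n ∸ d) e) (n∸n≡0 d) ⟩
  Q ^ (d * 0) * 1                               ≡⟨ cong (λ e → Q ^ e * 1) (*-zeroʳ d) ⟩
  1                                             ∎

weight-recurrence-d≤k : ∀ Q s d N J →
  (qint Q (suc d) + s * qint Q d) * weight Q (suc (d + N)) (suc (d + J)) d
  + (Q ^ suc d * qint Q N + s * (Q ^ d * qint Q (suc N))) * weight Q (suc (d + N)) (suc (d + J)) (suc d)
  ≡ Q ^ (d + J) * (s + Q) * qint Q (suc (d + J)) * weight Q (d + N) (d + J) d
  + (qint Q (suc (suc (d + J))) + s * qint Q (suc (d + J))) * weight Q (d + N) (suc (d + J)) d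
weight-recurrence-d≤k Q s d N J with J ≤? N
... | yes J≤N with m≤n⇒∃[o]m+o≡n J≤N
...   | M , refl = weight-recurrence-k≤n Q s d J M
weight-recurrence-d≤k Q s d N J | no J≰N = begin
  Aw * weight Q (suc (d + N)) (suc (d + J)) d + Bw * weight Q (suc (d + N)) (suc (d + J)) (suc d)
    ≡⟨ cong₂ (λ u v → Aw * u + Bw * v) (weight-k>n Q _ _ d (≤-trans (m≤m+n d N) (n≤1+n _)) (s≤s (+-monoʳ-< d N<J)))
                                      (weight-k>n Q _ _ (suc d) (s≤s (m≤m+n d N)) (s≤s (+-monoʳ-< d N<J))) ⟩
  Aw * 0 + Bw * 0 ≡⟨ cong₂ _+_ (*-zeroʳ Aw) (*-zeroʳ Bw) ⟩
  0               ≡⟨ cong₂ _+_ (*-zeroʳ Cw) (*-zeroʳ Ew) ⟨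
  Cw * 0 + Ew * 0
    ≡⟨ sym (cong₂ (λ u v → Cw * u + Ew * v) (weight-k>n Q _ _ d (m≤m+n d N) (+-monoʳ-< d N<J))
                                            (weight-k>n Q _ _ d (m≤m+n d N) (m<n⇒m<1+n (+-monoʳ-< d N<J)))) ⟩
  Cw * weight Q (d + N) (d + J) d + Ew * weight Q (d + N) (suc (d + J)) d ∎
  where
  N<J = ≰⇒> J≰N
  Aw = qint Q (suc d) + s * qint Q d
  Bw = Q ^ suc d * qint Q N + s * (Q ^ d * qint Q (suc N))
  Cw = Q ^ (d + J) * (s + Q) * qint Q (suc (d + J))
  Ew = qint Q (suc (suc (d + J))) + s * qint Q (suc (d + J))

weight-recurrence : ∀ Q s d N K →
  (qint Q (suc d) + s * qint Q d) * weight Q (suc (d + N)) (suc K) d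
  + (Q ^ suc d * qint Q N + s * (Q ^ d * qint Q (suc N))) * weight Q (suc (d + N)) (suc K) (suc d)
  ≡ Q ^ K * (s + Q) * qint Q (suc K) * weight Q (d + N) K d
  + (qint Q (suc (suc K)) + s * qint Q (suc K)) * weight Q (d + N) (suc K) d
weight-recurrence Q s d N K with <-cmp d (suc K)
... | tri< d<sK _ _ with m≤n⇒∃[o]m+o≡n (≤-pred d<sK)
...   | J , refl = weight-recurrence-d≤k Q s d N J
weight-recurrence Q s d N K | tri≈ _ refl _ = begin
  Aw * weight Q (suc (d + N)) d d + Bw * weight Q (suc (d + N)) d (suc d)
    ≡⟨ cong₂ (λ u v → Aw * u + Bw * v) (weight-diag Q (suc (d + N)) d) (weight-d>k Q (suc (d + N)) d (suc d) ≤-refl) ⟩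
  Aw * 1 + Bw * 0 ≡⟨ l Aw Bw Cw ⟩
  Cw * 0 + Aw * 1
    ≡⟨ sym (cong₂ (λ u v → Cw * u + Aw * v) (weight-d>k Q (d + N) K d ≤-refl) (weight-diag Q (d + N) d)) ⟩
  Cw * weight Q (d + N) K d + Aw * weight Q (d + N) d d ∎
  where
  Aw = qint Q (suc d) + s * qint Q d
  Bw = Q ^ suc d * qint Q N + s * (Q ^ d * qint Q (suc N))
  Cw = Q ^ K * (s + Q) * qint Q (suc K)
  l : ∀ a b c → a * 1 + b * 0 ≡ c * 0 + a * 1
  l = solve-∀
weight-recurrence Q s d N K | tri> _ _ sK<d = begin
  Aw * weight Q (suc (d + N)) (suc K) d + Bw * weight Q (suc (d + N)) (suc K) (suc d)
    ≡⟨ cong₂ (λ u v → Aw * u + Bw * v) (weight-d>k Q (suc (d + N)) (suc K) d sK<d) (weight-d>k Q (suc (d + N)) (suc K) (suc d) (m<n⇒m<1+n sK<d)) ⟩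
  Aw * 0 + Bw * 0 ≡⟨ cong₂ _+_ (*-zeroʳ Aw) (*-zeroʳ Bw) ⟩
  0               ≡⟨ cong₂ _+_ (*-zeroʳ Cw) (*-zeroʳ Ew) ⟨
  Cw * 0 + Ew * 0
    ≡⟨ sym (cong₂ (λ u v → Cw * u + Ew * v) (weight-d>k Q (d + N) K d (<-trans (n<1+n K) sK<d)) (weight-d>k Q (d + N) (suc K) d sK<d)) ⟩
  Cw * weight Q (d + N) K d + Ew * weight Q (d + N) (suc K) d ∎
  where
  Aw = qint Q (suc d) + s * qint Q d
  Bw = Q ^ suc d * qint Q N + s * (Q ^ d * qint Q (suc N))
  Cw = Q ^ K * (s + Q) * qint Q (suc K)
  Ew = qint Q (suc (suc K)) + s * qint Q (suc K)

weight-recurrence-zero : ∀ Q s d N →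
  (qint Q (suc d) + s * qint Q d) * weight Q (suc (d + N)) 0 d
  + (Q ^ suc d * qint Q N + s * (Q ^ d * qint Q (suc N))) * weight Q (suc (d + N)) 0 (suc d)
  ≡ weight Q (d + N) 0 d
weight-recurrence-zero Q s zero N = begin
  (1 + s * 0) * weight Q (suc N) 0 0 + Bw * weight Q (suc N) 0 1
    ≡⟨ cong₂ (λ u v → (1 + s * 0) * u + Bw * v) (weight-diag Q (suc N) 0) (weight-d>k Q (suc N) 0 1 ≤-refl) ⟩
  (1 + s * 0) * 1 + Bw * 0 ≡⟨ l s Bw ⟩
  1 ≡⟨ sym (weight-diag Q N 0) ⟩
  weight Q N 0 0 ∎
  where
  Bw = Q ^ 1 * qint Q N + s * (Q ^ 0 * qint Q (suc N))
  l : ∀ s b → (1 + s * 0) * 1 + b * 0 ≡ 1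
  l = solve-∀
weight-recurrence-zero Q s (suc d) N = begin
  Aw * weight Q (suc (suc d + N)) 0 (suc d) + Bw * weight Q (suc (suc d + N)) 0 (suc (suc d))
    ≡⟨ cong₂ (λ u v → Aw * u + Bw * v) (weight-d>k Q (suc (suc d + N)) 0 (suc d) (s≤s z≤n)) (weight-d>k Q (suc (suc d + N)) 0 (suc (suc d)) (s≤s z≤n)) ⟩
  Aw * 0 + Bw * 0 ≡⟨ l Aw Bw ⟩
  0 ≡⟨ sym (weight-d>k Q (suc d + N) 0 (suc d) (s≤s z≤n)) ⟩
  weight Q (suc d + N) 0 (suc d) ∎
  where
  Aw = qint Q (suc (suc d)) + s * qint Q (suc d)
  Bw = Q ^ suc (suc d) * qint Q N + s * (Q ^ suc d * qint Q (suc N))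
  l : ∀ a b → a * 0 + b * 0 ≡ 0
  l = solve-∀

insertAt : ℕ → Letter → List Letter → List Letter
insertAt zero y xs = y ∷ xs
insertAt (suc i) y [] = y ∷ []
insertAt (suc i) y (x ∷ xs) = x ∷ insertAt i y xs

bit : Bool → ℕ
bit true = 1
bit false = 0

descentsFrom-suc : ∀ i x ys → descentsFrom (suc i) x ys ≡ map suc (descentsFrom i x ys)
descentsFrom-suc i x [] = refl
descentsFrom-suc i x (y ∷ ys) with x >L y
... | true = cong (suc i ∷_) (descentsFrom-suc (suc i) y ys)
... | false = descentsFrom-suc (suc i) y ys

desAfter : Letter → List Letter → ℕ
desAfter x ys = length (descentsFrom 0 x ys)

majAfter : Letter → List Letter → ℕ
majAfter x ys = sum (descentsFrom 0 x ys)

sum-map-suc : ∀ (l : List ℕ) → sum (map suc l) ≡ length l + sum l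
sum-map-suc [] = refl
sum-map-suc (a ∷ l) = trans (cong (suc a +_) (sum-map-suc l)) (cong suc (lem a (length l) (sum l)))
  where lem : ∀ a b c → a + (b + c) ≡ b + (a + c)
        lem = solve-∀

desAfter-∷ : ∀ x y ys → desAfter x (y ∷ ys) ≡ bit (x >L y) + desAfter y ys
desAfter-∷ x y ys with x >L y
... | true = cong suc (trans (cong length (descentsFrom-suc 0 y ys)) (length-map suc (descentsFrom 0 y ys)))
... | false = trans (cong length (descentsFrom-suc 0 y ys)) (length-map suc (descentsFrom 0 y ys))

majAfter-∷ : ∀ x y ys → majAfter x (y ∷ ys) ≡ desAfter y ys + majAfter y ys
majAfter-∷ x y ys with x >L y
... | true = trans (cong sum (descentsFrom-suc 0 y ys)) (sum-map-suc (descentsFrom 0 y ys))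
... | false = trans (cong sum (descentsFrom-suc 0 y ys)) (sum-map-suc (descentsFrom 0 y ys))

desAfter≤length : ∀ x ys → desAfter x ys ≤ length ys
desAfter≤length x [] = z≤n
desAfter≤length x (y ∷ ys) rewrite desAfter-∷ x y ys with x >L y
... | true = s≤s (desAfter≤length y ys)
... | false = m≤n⇒m≤1+n (desAfter≤length y ys)

MaxOver : Letter → List Letter → Set
MaxOver y us = All (λ u → (y >L u ≡ true) × (u >L y ≡ false)) us

MinOver : Letter → List Letter → Set
MinOver y us = All (λ u → (y >L u ≡ false) × (u >L y ≡ true)) us

insertion-shift : ∀ Q (f : ℕ → ℕ) x y1 zs →
  Q ^ majAfter x (y1 ∷ zs) * f (desAfter x (y1 ∷ zs)) ≡ Q ^ majAfter y1 zs * (Q ^ desAfter y1 zs * f (bit (x >L y1) + desAfter y1 zs))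
insertion-shift Q f x y1 zs = begin
  Q ^ majAfter x (y1 ∷ zs) * f (desAfter x (y1 ∷ zs))
    ≡⟨ cong₂ (λ u v → Q ^ u * f v) (majAfter-∷ x y1 zs) (desAfter-∷ x y1 zs) ⟩
  Q ^ (desAfter y1 zs + majAfter y1 zs) * f (bit (x >L y1) + desAfter y1 zs)
    ≡⟨ cong (_* f (bit (x >L y1) + desAfter y1 zs)) (^-distribˡ-+-* Q (desAfter y1 zs) (majAfter y1 zs)) ⟩
  Q ^ desAfter y1 zs * Q ^ majAfter y1 zs * f (bit (x >L y1) + desAfter y1 zs)
    ≡⟨ l (Q ^ desAfter y1 zs) (Q ^ majAfter y1 zs) _ ⟩
  Q ^ majAfter y1 zs * (Q ^ desAfter y1 zs * f (bit (x >L y1) + desAfter y1 zs)) ∎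
  where l : ∀ a b c → a * b * c ≡ b * (a * c)
        l = solve-∀

pow-split₃ : ∀ Q a c s → Q ^ ((a + c) + (c + s)) ≡ Q ^ a * Q ^ c * Q ^ c * Q ^ s
pow-split₃ Q a c s = begin
  Q ^ ((a + c) + (c + s)) ≡⟨ ^-distribˡ-+-* Q (a + c) (c + s) ⟩
  Q ^ (a + c) * Q ^ (c + s) ≡⟨ cong₂ _*_ (^-distribˡ-+-* Q a c) (^-distribˡ-+-* Q c s) ⟩
  Q ^ a * Q ^ c * (Q ^ c * Q ^ s) ≡⟨ l (Q ^ a) (Q ^ c) (Q ^ s) ⟩
  Q ^ a * Q ^ c * Q ^ c * Q ^ s ∎
  where l : ∀ x y z → x * y * (y * z) ≡ x * y * y * z
        l = solve-∀

suc∸ : ∀ {c m} → c ≤ m → suc m ∸ c ≡ suc (m ∸ c)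
suc∸ c≤m = +-∸-assoc 1 c≤m

insertMax-identity : ∀ Q (f : ℕ → ℕ) b c s m → c ≤ m →
  Q ^ ((1 + c) + (c + s)) * f (1 + c)
  + Q ^ s * (qint Q (suc c) * (Q ^ c * f (bit b + c)) + Q ^ suc c * qint Q (m ∸ c) * (Q ^ suc c * f (bit b + suc c)))
  ≡ Q ^ (c + s) * (qint Q (suc (bit b + c)) * f (bit b + c) + Q ^ suc (bit b + c) * qint Q (suc m ∸ (bit b + c)) * f (suc (bit b + c)))
insertMax-identity Q f true c s m c≤m = begin
  Q ^ ((1 + c) + (c + s)) * f (1 + c)
  + Q ^ s * (qint Q (suc c) * (Q ^ c * f (suc c)) + Q ^ suc c * qint Q (m ∸ c) * (Q ^ suc c * f (suc (suc c))))
    ≡⟨ cong₂ _+_ (cong (_* f (1 + c)) (pow-split₃ Q 1 c s)) refl ⟩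
  Q ^ 1 * Q ^ c * Q ^ c * Q ^ s * f (1 + c)
  + Q ^ s * (qint Q (suc c) * (Q ^ c * f (suc c)) + Q * Q ^ c * qint Q (m ∸ c) * (Q * Q ^ c * f (suc (suc c))))
    ≡⟨ l Q (Q ^ c) (Q ^ s) (qint Q (suc c)) (qint Q (m ∸ c)) (f (suc c)) (f (suc (suc c))) ⟩
  Q ^ c * Q ^ s * ((qint Q (suc c) + Q * Q ^ c) * f (suc c) + Q * (Q * Q ^ c) * qint Q (m ∸ c) * f (suc (suc c)))
    ≡⟨ cong₂ (λ u v → u * (v * f (suc c) + Q * (Q * Q ^ c) * qint Q (m ∸ c) * f (suc (suc c))))
         (sym (^-distribˡ-+-* Q c s)) (sym (qint-sucʳ Q (suc c))) ⟩
  Q ^ (c + s) * (qint Q (suc (suc c)) * f (suc c) + Q ^ suc (suc c) * qint Q (m ∸ c) * f (suc (suc c))) ∎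
  where l : ∀ Q Qc Qs A M F1 F2 → Q * 1 * Qc * Qc * Qs * F1 + Qs * (A * (Qc * F1) + Q * Qc * M * (Q * Qc * F2))
            ≡ Qc * Qs * ((A + Q * Qc) * F1 + Q * (Q * Qc) * M * F2)
        l = solve-∀
insertMax-identity Q f false c s m c≤m = begin
  Q ^ ((1 + c) + (c + s)) * f (1 + c)
  + Q ^ s * (qint Q (suc c) * (Q ^ c * f c) + Q ^ suc c * qint Q (m ∸ c) * (Q ^ suc c * f (suc c)))
    ≡⟨ cong₂ _+_ (cong (_* f (1 + c)) (pow-split₃ Q 1 c s)) refl ⟩
  Q ^ 1 * Q ^ c * Q ^ c * Q ^ s * f (1 + c)
  + Q ^ s * (qint Q (suc c) * (Q ^ c * f c) + Q * Q ^ c * qint Q (m ∸ c) * (Q * Q ^ c * f (suc c)))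
    ≡⟨ l Q (Q ^ c) (Q ^ s) (qint Q (suc c)) (qint Q (m ∸ c)) (f c) (f (suc c)) ⟩
  Q ^ c * Q ^ s * (qint Q (suc c) * f c + Q * Q ^ c * (1 + Q * qint Q (m ∸ c)) * f (suc c))
    ≡⟨ cong₂ (λ u v → u * (qint Q (suc c) * f c + Q * Q ^ c * v * f (suc c)))
         (sym (^-distribˡ-+-* Q c s)) (sym (trans (cong (qint Q) (suc∸ c≤m)) (qint-suc Q (m ∸ c)))) ⟩
  Q ^ (c + s) * (qint Q (suc c) * f c + Q ^ suc c * qint Q (suc m ∸ c) * f (suc c)) ∎
  where l : ∀ Q Qc Qs A M F0 F1 → Q * 1 * Qc * Qc * Qs * F1 + Qs * (A * (Qc * F0) + Q * Qc * M * (Q * Qc * F1))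
            ≡ Qc * Qs * (A * F0 + Q * Qc * (1 + Q * M) * F1)
        l = solve-∀

insertMin-identity : ∀ Q (f : ℕ → ℕ) b c s m → c ≤ m →
  Q ^ ((0 + c) + (c + s)) * f (1 + (0 + c))
  + Q ^ s * (qint Q c * (Q ^ c * f (bit b + c)) + Q ^ c * qint Q (suc m ∸ c) * (Q ^ suc c * f (bit b + suc c)))
  ≡ Q ^ (c + s) * (qint Q (bit b + c) * f (bit b + c) + Q ^ (bit b + c) * qint Q (suc (suc m) ∸ (bit b + c)) * f (suc (bit b + c)))
insertMin-identity Q f true c s m c≤m = begin
  Q ^ ((0 + c) + (c + s)) * f (suc c)
  + Q ^ s * (qint Q c * (Q ^ c * f (suc c)) + Q ^ c * qint Q (suc m ∸ c) * (Q ^ suc c * f (suc (suc c))))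
    ≡⟨ cong₂ _+_ (cong (_* f (suc c)) (pow-split₃ Q 0 c s)) refl ⟩
  Q ^ 0 * Q ^ c * Q ^ c * Q ^ s * f (suc c)
  + Q ^ s * (qint Q c * (Q ^ c * f (suc c)) + Q ^ c * qint Q (suc m ∸ c) * (Q * Q ^ c * f (suc (suc c))))
    ≡⟨ l Q (Q ^ c) (Q ^ s) (qint Q c) (qint Q (suc m ∸ c)) (f (suc c)) (f (suc (suc c))) ⟩
  Q ^ c * Q ^ s * ((qint Q c + Q ^ c) * f (suc c) + Q * Q ^ c * qint Q (suc m ∸ c) * f (suc (suc c)))
    ≡⟨ cong₂ (λ u v → u * (v * f (suc c) + Q * Q ^ c * qint Q (suc m ∸ c) * f (suc (suc c))))
         (sym (^-distribˡ-+-* Q c s)) (sym (qint-sucʳ Q c)) ⟩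
  Q ^ (c + s) * (qint Q (suc c) * f (suc c) + Q ^ suc c * qint Q (suc m ∸ c) * f (suc (suc c))) ∎
  where l : ∀ Q Qc Qs A M F1 F2 → 1 * Qc * Qc * Qs * F1 + Qs * (A * (Qc * F1) + Qc * M * (Q * Qc * F2))
            ≡ Qc * Qs * ((A + Qc) * F1 + Q * Qc * M * F2)
        l = solve-∀
insertMin-identity Q f false c s m c≤m = begin
  Q ^ ((0 + c) + (c + s)) * f (suc c)
  + Q ^ s * (qint Q c * (Q ^ c * f c) + Q ^ c * qint Q (suc m ∸ c) * (Q ^ suc c * f (suc c)))
    ≡⟨ cong₂ _+_ (cong (_* f (suc c)) (pow-split₃ Q 0 c s)) refl ⟩
  Q ^ 0 * Q ^ c * Q ^ c * Q ^ s * f (suc c)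
  + Q ^ s * (qint Q c * (Q ^ c * f c) + Q ^ c * qint Q (suc m ∸ c) * (Q * Q ^ c * f (suc c)))
    ≡⟨ l Q (Q ^ c) (Q ^ s) (qint Q c) (qint Q (suc m ∸ c)) (f c) (f (suc c)) ⟩
  Q ^ c * Q ^ s * (qint Q c * f c + Q ^ c * (1 + Q * qint Q (suc m ∸ c)) * f (suc c))
    ≡⟨ cong₂ (λ u v → u * (qint Q c * f c + Q ^ c * v * f (suc c)))
         (sym (^-distribˡ-+-* Q c s)) (sym (trans (cong (qint Q) (suc∸ (m≤n⇒m≤1+n c≤m))) (qint-suc Q (suc m ∸ c)))) ⟩
  Q ^ (c + s) * (qint Q c * f c + Q ^ c * qint Q (suc (suc m) ∸ c) * f (suc c)) ∎
  where l : ∀ Q Qc Qs A M F0 F1 → 1 * Qc * Qc * Qs * F1 + Qs * (A * (Qc * F0) + Qc * M * (Q * Qc * F1))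
            ≡ Qc * Qs * (A * F0 + Qc * (1 + Q * M) * F1)
        l = solve-∀

insertionSum : ℕ → (ℕ → ℕ) → Letter → Letter → List Letter → ℕ
insertionSum Q f y x ys = Σ< (suc (length ys)) (λ i → Q ^ majAfter x (insertAt i y ys) * f (desAfter x (insertAt i y ys)))

insertionSum-max : ∀ Q (f : ℕ → ℕ) y x ys → MaxOver y (x ∷ ys) →
  insertionSum Q f y x ys
  ≡ Q ^ majAfter x ys * (qint Q (suc (desAfter x ys)) * f (desAfter x ys) + Q ^ suc (desAfter x ys) * qint Q (length ys ∸ desAfter x ys) * f (suc (desAfter x ys)))
insertionSum-max Q f y x [] ((_ , xy) ∷ []) rewrite xy = l Q (f 0) (f 1)
  where l : ∀ Q a b → 1 * a + 0 ≡ 1 * (1 * a + Q * 1 * 0 * b)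
        l = solve-∀
insertionSum-max Q f y x (y1 ∷ ys) ((_ , tx) ∷ (ty1 , t1) ∷ hs) = begin
  Q ^ majAfter x (y ∷ y1 ∷ ys) * f (desAfter x (y ∷ y1 ∷ ys))
  + Σ< (suc (length ys)) (λ i → Q ^ majAfter x (y1 ∷ insertAt i y ys) * f (desAfter x (y1 ∷ insertAt i y ys)))
    ≡⟨ cong₂ _+_ (cong₂ (λ u v → Q ^ u * f v) e-sm e-cnt)
         (Σ<-cong (suc (length ys)) (λ i → insertion-shift Q f x y1 (insertAt i y ys))) ⟩
  Q ^ ((1 + c) + (c + s)) * f (1 + c)
  + insertionSum Q f' y y1 ys
    ≡⟨ cong (Q ^ ((1 + c) + (c + s)) * f (1 + c) +_) (insertionSum-max Q f' y y1 ys ((ty1 , t1) ∷ hs)) ⟩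
  Q ^ ((1 + c) + (c + s)) * f (1 + c)
  + Q ^ s * (qint Q (suc c) * (Q ^ c * f (bit b + c)) + Q ^ suc c * qint Q (length ys ∸ c) * (Q ^ suc c * f (bit b + suc c)))
    ≡⟨ insertMax-identity Q f b c s (length ys) (desAfter≤length y1 ys) ⟩
  Q ^ (c + s) * (qint Q (suc (bit b + c)) * f (bit b + c) + Q ^ suc (bit b + c) * qint Q (suc (length ys) ∸ (bit b + c)) * f (suc (bit b + c)))
    ≡⟨ sym (cong₂ (λ u v → Q ^ u * (qint Q (suc v) * f v + Q ^ suc v * qint Q (suc (length ys) ∸ v) * f (suc v)))
              (majAfter-∷ x y1 ys) (desAfter-∷ x y1 ys)) ⟩
  Q ^ majAfter x (y1 ∷ ys) * (qint Q (suc (desAfter x (y1 ∷ ys))) * f (desAfter x (y1 ∷ ys))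
    + Q ^ suc (desAfter x (y1 ∷ ys)) * qint Q (length (y1 ∷ ys) ∸ desAfter x (y1 ∷ ys)) * f (suc (desAfter x (y1 ∷ ys)))) ∎
  where
  b = x >L y1
  c = desAfter y1 ys
  s = majAfter y1 ys
  f' : ℕ → ℕ
  f' e = Q ^ e * f (bit b + e)
  e-cnt1 : desAfter y (y1 ∷ ys) ≡ 1 + c
  e-cnt1 = trans (desAfter-∷ y y1 ys) (cong (λ t → bit t + c) ty1)
  e-sm : majAfter x (y ∷ y1 ∷ ys) ≡ (1 + c) + (c + s)
  e-sm = trans (majAfter-∷ x y (y1 ∷ ys)) (cong₂ _+_ e-cnt1 (majAfter-∷ y y1 ys))
  e-cnt : desAfter x (y ∷ y1 ∷ ys) ≡ 1 + c
  e-cnt = trans (desAfter-∷ x y (y1 ∷ ys)) (cong₂ (λ t u → bit t + u) tx e-cnt1)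

insertionSum-min : ∀ Q (f : ℕ → ℕ) y x ys → MinOver y (x ∷ ys) →
  insertionSum Q f y x ys
  ≡ Q ^ majAfter x ys * (qint Q (desAfter x ys) * f (desAfter x ys) + Q ^ desAfter x ys * qint Q (suc (length ys) ∸ desAfter x ys) * f (suc (desAfter x ys)))
insertionSum-min Q f y x [] ((_ , xy) ∷ []) rewrite xy = l Q (f 0) (f 1)
  where l : ∀ Q a b → 1 * b + 0 ≡ 1 * (0 * a + 1 * 1 * b)
        l = solve-∀
insertionSum-min Q f y x (y1 ∷ ys) ((_ , tx) ∷ (ty1 , t1) ∷ hs) = begin
  Q ^ majAfter x (y ∷ y1 ∷ ys) * f (desAfter x (y ∷ y1 ∷ ys))
  + Σ< (suc (length ys)) (λ i → Q ^ majAfter x (y1 ∷ insertAt i y ys) * f (desAfter x (y1 ∷ insertAt i y ys)))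
    ≡⟨ cong₂ _+_ (cong₂ (λ u v → Q ^ u * f v) e-sm e-cnt)
         (Σ<-cong (suc (length ys)) (λ i → insertion-shift Q f x y1 (insertAt i y ys))) ⟩
  Q ^ ((0 + c) + (c + s)) * f (1 + (0 + c))
  + insertionSum Q f' y y1 ys
    ≡⟨ cong (Q ^ ((0 + c) + (c + s)) * f (1 + (0 + c)) +_) (insertionSum-min Q f' y y1 ys ((ty1 , t1) ∷ hs)) ⟩
  Q ^ ((0 + c) + (c + s)) * f (1 + (0 + c))
  + Q ^ s * (qint Q c * (Q ^ c * f (bit b + c)) + Q ^ c * qint Q (suc (length ys) ∸ c) * (Q ^ suc c * f (bit b + suc c)))
    ≡⟨ insertMin-identity Q f b c s (length ys) (desAfter≤length y1 ys) ⟩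
  Q ^ (c + s) * (qint Q (bit b + c) * f (bit b + c) + Q ^ (bit b + c) * qint Q (suc (suc (length ys)) ∸ (bit b + c)) * f (suc (bit b + c)))
    ≡⟨ sym (cong₂ (λ u v → Q ^ u * (qint Q v * f v + Q ^ v * qint Q (suc (suc (length ys)) ∸ v) * f (suc v)))
              (majAfter-∷ x y1 ys) (desAfter-∷ x y1 ys)) ⟩
  Q ^ majAfter x (y1 ∷ ys) * (qint Q (desAfter x (y1 ∷ ys)) * f (desAfter x (y1 ∷ ys))
    + Q ^ desAfter x (y1 ∷ ys) * qint Q (suc (length (y1 ∷ ys)) ∸ desAfter x (y1 ∷ ys)) * f (suc (desAfter x (y1 ∷ ys)))) ∎
  where
  b = x >L y1
  c = desAfter y1 ys
  s = majAfter y1 ys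
  f' : ℕ → ℕ
  f' e = Q ^ e * f (bit b + e)
  e-cnt1 : desAfter y (y1 ∷ ys) ≡ 0 + c
  e-cnt1 = trans (desAfter-∷ y y1 ys) (cong (λ t → bit t + c) ty1)
  e-sm : majAfter x (y ∷ y1 ∷ ys) ≡ (0 + c) + (c + s)
  e-sm = trans (majAfter-∷ x y (y1 ∷ ys)) (cong₂ _+_ e-cnt1 (majAfter-∷ y y1 ys))
  e-cnt : desAfter x (y ∷ y1 ∷ ys) ≡ 1 + (0 + c)
  e-cnt = trans (desAfter-∷ x y (y1 ∷ ys)) (cong₂ (λ t u → bit t + u) tx e-cnt1)

ValidLetter : ℕ → ℕ → Letter → Set
ValidLetter r n l = InRange n (proj₁ l) × proj₂ l < r

alphabet : ℕ → ℕ → List Letter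
alphabet r n = concatMap (λ a → map (a ,_) (upTo r)) (map suc (upTo n))

∈-alphabet⁻ : ∀ {r n l} → l ∈ alphabet r n → ValidLetter r n l
∈-alphabet⁻ {r} {n} {l} m with find (∈-concatMap⁻ (λ a → map (a ,_) (upTo r)) {xs = map suc (upTo n)} m)
... | a , a∈ , l∈ with ∈-map⁻ suc {xs = upTo n} a∈ | ∈-map⁻ (a ,_) {xs = upTo r} l∈
...   | a' , a'∈ , refl | z , z∈ , refl = (s≤s z≤n , ∈-upTo⁻ a'∈) , ∈-upTo⁻ z∈

∈-alphabet⁺ : ∀ {r n l} → ValidLetter r n l → l ∈ alphabet r n
∈-alphabet⁺ {r} {n} {suc a , z} ((_ , a≤n) , z<r) =
  ∈-concatMap⁺ (λ a → map (a ,_) (upTo r)) {xs = map suc (upTo n)} (lose (∈-map⁺ suc (∈-upTo⁺ a≤n)) (∈-map⁺ (suc a ,_) (∈-upTo⁺ z<r)))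

Unique-alphabet : ∀ r n → Unique (alphabet r n)
Unique-alphabet r n = Unique-concatMap⁺ (λ a → map (a ,_) (upTo r)) (map suc (upTo n))
  (UP.map⁺ suc-injective (UP.upTo⁺ n))
  (λ {a} _ → UP.map⁺ ,-injectiveʳ (UP.upTo⁺ r))
  dj
  where
  dj : ∀ {a b w} → a ∈ map suc (upTo n) → b ∈ map suc (upTo n) → w ∈ map (a ,_) (upTo r) → w ∈ map (b ,_) (upTo r) → a ≡ b
  dj {a} {b} _ _ m1 m2 with ∈-map⁻ (a ,_) m1 | ∈-map⁻ (b ,_) m2
  ... | _ , _ , refl | _ , _ , e = cong proj₁ e

∈-words⁻ : ∀ {A : Set} m (L : List A) {w} → w ∈ words m L → length w ≡ m × All (_∈ L) w
∈-words⁻ zero L (here refl) = refl , []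
∈-words⁻ (suc m) L {w} mem with find (∈-concatMap⁻ (λ a → map (a ∷_) (words m L)) {xs = L} mem)
... | a , a∈ , w∈ with ∈-map⁻ (a ∷_) {xs = words m L} w∈
...   | w' , w'∈ , refl with ∈-words⁻ m L w'∈
...     | e , al = cong suc e , (a∈ ∷ al)

∈-words⁺ : ∀ {A : Set} m (L : List A) {w} → length w ≡ m → All (_∈ L) w → w ∈ words m L
∈-words⁺ zero L {[]} _ _ = here refl
∈-words⁺ (suc m) L {a ∷ w} e (a∈ ∷ al) =
  ∈-concatMap⁺ (λ a → map (a ∷_) (words m L)) {xs = L} (lose a∈ (∈-map⁺ (a ∷_) (∈-words⁺ m L (suc-injective e) al)))

Unique-words : ∀ {A : Set} m (L : List A) → Unique L → Unique (words m L)
Unique-words zero L _ = [] ∷ []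
Unique-words (suc m) L uL = Unique-concatMap⁺ (λ a → map (a ∷_) (words m L)) L uL
  (λ _ → UP.map⁺ (λ e → ∷-injectiveʳ e) (Unique-words m L uL)) dj
  where
  dj : ∀ {a b w} → a ∈ L → b ∈ L → w ∈ map (a ∷_) (words m L) → w ∈ map (b ∷_) (words m L) → a ≡ b
  dj {a} {b} _ _ m1 m2 with ∈-map⁻ (a ∷_) m1 | ∈-map⁻ (b ∷_) m2
  ... | _ , _ , refl | _ , _ , e = ∷-injectiveˡ e

any-false⁻ : ∀ x xs → any (x ≡ᵇ_) xs ≡ false → x ∉ xs
any-false⁻ x (y ∷ xs) e (here refl) with x ≡ᵇ x in eq
... | true = case e
  where case : true ≡ false → ⊥
        case ()
... | false = subst T eq (≡⇒≡ᵇ x x refl)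
any-false⁻ x (y ∷ xs) e (there m) with x ≡ᵇ y
... | true = case e
  where case : true ≡ false → ⊥
        case ()
... | false = any-false⁻ x xs e m

any-false⁺ : ∀ x xs → x ∉ xs → any (x ≡ᵇ_) xs ≡ false
any-false⁺ x [] _ = refl
any-false⁺ x (y ∷ xs) n∈ with x ≡ᵇ y in eq
... | true = ⊥-elim (n∈ (here (≡ᵇ⇒≡ x y (subst T (sym eq) tt))))
... | false = any-false⁺ x xs (λ m → n∈ (there m))

distinct⇒Unique : ∀ xs → distinct xs ≡ true → Unique xs
distinct⇒Unique [] _ = []
distinct⇒Unique (x ∷ xs) e with any (x ≡ᵇ_) xs in eq | distinct xs in eq2
... | false | true = AllP.¬Any⇒All¬ xs (any-false⁻ x xs eq) ∷ distinct⇒Unique xs eq2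
... | true | _ = ⊥-elim (case e)
  where case : false ≡ true → ⊥
        case ()
... | false | false = ⊥-elim (case e)
  where case : false ≡ true → ⊥
        case ()

Unique⇒distinct : ∀ xs → Unique xs → distinct xs ≡ true
Unique⇒distinct [] _ = refl
Unique⇒distinct (x ∷ xs) (a ∷ u) rewrite any-false⁺ x xs (AllP.All¬⇒¬Any a) = Unique⇒distinct xs u

IsColoredPerm : ℕ → ℕ → List Letter → Set
IsColoredPerm r n w = length w ≡ n × All (ValidLetter r n) w × Unique (map proj₁ w)

isPermWord? = λ (w : List Letter) → distinct (map proj₁ w) B.≟ true

∈-coloredPerms⁻ : ∀ {r n w} → w ∈ coloredPerms r n → IsColoredPerm r n w
∈-coloredPerms⁻ {r} {n} {w} m with ∈-filter⁻ isPermWord? {xs = words n (alphabet r n)} m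
... | w∈ , d with ∈-words⁻ n (alphabet r n) w∈
...   | e , al = e , All.map ∈-alphabet⁻ al , distinct⇒Unique _ d

∈-coloredPerms⁺ : ∀ {r n w} → IsColoredPerm r n w → w ∈ coloredPerms r n
∈-coloredPerms⁺ {r} {n} {w} (e , al , u) = ∈-filter⁺ isPermWord? {xs = words n (alphabet r n)} (∈-words⁺ n (alphabet r n) e (All.map ∈-alphabet⁺ al)) (Unique⇒distinct _ u)

Unique-coloredPerms : ∀ r n → Unique (coloredPerms r n)
Unique-coloredPerms r n = UP.filter⁺ isPermWord? (Unique-words n (alphabet r n) (Unique-alphabet r n))

length-insertAt : ∀ i y (σ : List Letter) → length (insertAt i y σ) ≡ suc (length σ)
length-insertAt zero y σ = refl
length-insertAt (suc i) y [] = refl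
length-insertAt (suc i) y (x ∷ σ) = cong suc (length-insertAt i y σ)

All-insertAt : ∀ {P : Letter → Set} i y σ → P y → All P σ → All P (insertAt i y σ)
All-insertAt zero y σ p a = p ∷ a
All-insertAt (suc i) y [] p a = p ∷ []
All-insertAt (suc i) y (x ∷ σ) p (px ∷ a) = px ∷ All-insertAt i y σ p a

Unique-insertAt : ∀ i y (σ : List Letter) → Unique (map proj₁ σ) → All (λ l → proj₁ y ≢ proj₁ l) σ → Unique (map proj₁ (insertAt i y σ))
Unique-insertAt zero y σ u a = toAll σ a ∷ u
  where toAll : ∀ τ → All (λ l → proj₁ y ≢ proj₁ l) τ → All (proj₁ y ≢_) (map proj₁ τ)
        toAll [] _ = []
        toAll (t ∷ τ) (p ∷ q) = p ∷ toAll τ q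
Unique-insertAt (suc i) y [] u a = [] ∷ []
Unique-insertAt (suc i) y (x ∷ σ) (ux ∷ u) (px ∷ a) = allI i σ ux (λ e → px (sym e)) ∷ Unique-insertAt i y σ u a
  where allI : ∀ i τ → All (proj₁ x ≢_) (map proj₁ τ) → proj₁ x ≢ proj₁ y → All (proj₁ x ≢_) (map proj₁ (insertAt i y τ))
        allI zero τ q n = n ∷ q
        allI (suc i) [] q n = n ∷ []
        allI (suc i) (t ∷ τ) (p ∷ q) n = p ∷ allI i τ q n

insertAt-length-++ : ∀ (pre post : List Letter) y → insertAt (length pre) y (pre ++ post) ≡ pre ++ y ∷ post
insertAt-length-++ [] post y = refl
insertAt-length-++ (x ∷ pre) post y = cong (x ∷_) (insertAt-length-++ pre post y)

insertAt-injective : ∀ c z z' i i' (σ σ' : List Letter) → i ≤ length σ → i' ≤ length σ' →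
  All (λ l → c ≢ proj₁ l) σ → All (λ l → c ≢ proj₁ l) σ' →
  insertAt i (c , z) σ ≡ insertAt i' (c , z') σ' → i ≡ i' × z ≡ z' × σ ≡ σ'
insertAt-injective c z z' zero zero σ σ' _ _ _ _ e = refl , ,-injectiveʳ (∷-injectiveˡ e) , ∷-injectiveʳ e
insertAt-injective c z z' zero (suc i') σ (x' ∷ σ') _ _ _ (p ∷ _) e = ⊥-elim (p (cong proj₁ (∷-injectiveˡ e)))
insertAt-injective c z z' (suc i) zero (x ∷ σ) σ' _ _ (p ∷ _) _ e = ⊥-elim (p (cong proj₁ (sym (∷-injectiveˡ e))))
insertAt-injective c z z' (suc i) (suc i') (x ∷ σ) (x' ∷ σ') (s≤s l1) (s≤s l2) (_ ∷ a) (_ ∷ a') e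
  with insertAt-injective c z z' i i' σ σ' l1 l2 a a' (∷-injectiveʳ e)
... | refl , refl , refl = refl , refl , cong (_∷ σ) (∷-injectiveˡ e)

ValidLetter⇒≢suc : ∀ {r n} (σ : List Letter) → All (ValidLetter r n) σ → All (λ l → suc n ≢ proj₁ l) σ
ValidLetter⇒≢suc [] _ = []
ValidLetter⇒≢suc (x ∷ σ) (((_ , le) , _) ∷ a) = (λ e → <⇒≱ (s≤s le) (≤-reflexive e)) ∷ ValidLetter⇒≢suc σ a

ValidLetter-suc : ∀ {r n} (σ : List Letter) → All (ValidLetter r n) σ → All (ValidLetter r (suc n)) σ
ValidLetter-suc σ a = All.map (λ { ((p , q) , z) → (p , m≤n⇒m≤1+n q) , z }) a

insertions : ℕ → ℕ → List Letter → List (List Letter)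
insertions r n σ = concatMap (λ z → map (λ i → insertAt i (suc n , z) σ) (upTo (suc n))) (upTo r)

allInsertions : ℕ → ℕ → List (List Letter)
allInsertions r n = concatMap (insertions r n) (coloredPerms r n)

∈-insertions⁻ : ∀ {r n σ w} → w ∈ insertions r n σ → ∃ λ z → ∃ λ i → z < r × i < suc n × w ≡ insertAt i (suc n , z) σ
∈-insertions⁻ {r} {n} {σ} {w} m with find (∈-concatMap⁻ (λ z → map (λ i → insertAt i (suc n , z) σ) (upTo (suc n))) {xs = upTo r} m)
... | z , z∈ , w∈ with ∈-map⁻ (λ i → insertAt i (suc n , z) σ) {xs = upTo (suc n)} w∈
...   | i , i∈ , e = z , i , ∈-upTo⁻ z∈ , ∈-upTo⁻ i∈ , e

∈-insertions⁺ : ∀ {r n σ z i} → z < r → i < suc n → insertAt i (suc n , z) σ ∈ insertions r n σ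
∈-insertions⁺ {r} {n} {σ} {z} {i} z<r i<n =
  ∈-concatMap⁺ (λ z → map (λ i → insertAt i (suc n , z) σ) (upTo (suc n))) {xs = upTo r}
    (lose (∈-upTo⁺ z<r) (∈-map⁺ (λ i → insertAt i (suc n , z) σ) (∈-upTo⁺ i<n)))

∈-allInsertions⁻ : ∀ {r n w} → w ∈ allInsertions r n → IsColoredPerm r (suc n) w
∈-allInsertions⁻ {r} {n} {w} m with find (∈-concatMap⁻ (insertions r n) {xs = coloredPerms r n} m)
... | σ , σ∈ , w∈ with ∈-insertions⁻ {r} {n} {σ} w∈ | ∈-coloredPerms⁻ {r} {n} σ∈
...   | z , i , z<r , i<n , refl | len , al , u =
  trans (length-insertAt i _ σ) (cong suc len) ,
  All-insertAt i _ σ ((s≤s z≤n , ≤-refl) , z<r) (ValidLetter-suc σ al) ,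
  Unique-insertAt i _ σ u (ValidLetter⇒≢suc σ al)

All-ValidLetter-pred : ∀ {r n} w → All (ValidLetter r (suc n)) w → suc n ∉ map proj₁ w → All (ValidLetter r n) w
All-ValidLetter-pred w p n∉ =
  All.zipWith (λ ((_ , z<r) , a∈) → a∈ , z<r) (p , AllP.map⁻ (All-InRange-pred (map proj₁ w) (AllP.map⁺ (All.map proj₁ p)) n∉))

maxLetter-∈ : ∀ {r n w} → IsColoredPerm r (suc n) w → suc n ∈ map proj₁ w
maxLetter-∈ {r} {n} {w} (len , p , u) with suc n ∈? map proj₁ w
... | yes n∈ = n∈
... | no n∉ = ⊥-elim (1+n≰n (subst (_≤ n) (trans (length-map proj₁ w) len)
                (Unique-InRange-length n (map proj₁ w) u (AllP.map⁺ (All.map proj₁ (All-ValidLetter-pred w p n∉))))))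

IsColoredPerm-deleteMax : ∀ {r n} pre post z → IsColoredPerm r (suc n) (pre ++ (suc n , z) ∷ post) →
  IsColoredPerm r n (pre ++ post) × z < r
IsColoredPerm-deleteMax {r} {n} pre post z (len , p , u) =
  (length-pre++post , All-ValidLetter-pred (pre ++ post) (All-delete pre p) n∉ , u′) , proj₂ (All.head (AllP.++⁻ʳ pre p))
  where
  length-pre++post : length (pre ++ post) ≡ n
  length-pre++post = suc-injective (trans (sym (length-++-sucʳ pre (suc n , z) post)) len)
  split : Unique (map proj₁ (pre ++ post)) × suc n ∉ map proj₁ (pre ++ post)
  split rewrite map-++ proj₁ pre post = Unique-delete (map proj₁ pre) (subst Unique (map-++ proj₁ pre ((suc n , z) ∷ post)) u)
  u′ = proj₁ split
  n∉ = proj₂ split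

∈-allInsertions⁺ : ∀ {r n w} → IsColoredPerm r (suc n) w → w ∈ allInsertions r n
∈-allInsertions⁺ {r} {n} {w} vw with (c , z) , l∈ , refl ← ∈-map⁻ proj₁ (maxLetter-∈ vw)
  with pre , post , refl ← ∈-∃++ l∈ with vσ , z<r ← IsColoredPerm-deleteMax pre post z vw =
  subst (_∈ allInsertions r n) (insertAt-length-++ pre post (suc n , z))
    (∈-concatMap⁺ (insertions r n) {xs = coloredPerms r n} (lose (∈-coloredPerms⁺ vσ)
      (∈-insertions⁺ {r} {n} {pre ++ post} z<r (s≤s (subst (length pre ≤_) (proj₁ vσ) (length-++-≤ˡ pre))))))

Unique-allInsertions : ∀ r n → Unique (allInsertions r n)
Unique-allInsertions r n = Unique-concatMap⁺ (insertions r n) (coloredPerms r n) (Unique-coloredPerms r n) uf dj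
  where
  info : ∀ {σ} → σ ∈ coloredPerms r n → length σ ≡ n × All (λ l → suc n ≢ proj₁ l) σ
  info {σ} m with ∈-coloredPerms⁻ {r} {n} m
  ... | len , al , _ = len , ValidLetter⇒≢suc σ al
  uf : ∀ {σ} → σ ∈ coloredPerms r n → Unique (insertions r n σ)
  uf {σ} m = Unique-concatMap⁺ (λ z → map (λ i → insertAt i (suc n , z) σ) (upTo (suc n))) (upTo r)
    (UP.upTo⁺ r)
    (λ {z} _ → Unique-map∈⁺ (λ i → insertAt i (suc n , z) σ) (upTo (suc n))
       (UP.upTo⁺ (suc n))
       (λ {i} {i'} m1 m2 e → proj₁ (insertAt-injective (suc n) z z i i' σ σ
          (subst (i ≤_) (sym (proj₁ (info m))) (≤-pred (∈-upTo⁻ m1)))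
          (subst (i' ≤_) (sym (proj₁ (info m))) (≤-pred (∈-upTo⁻ m2)))
          (proj₂ (info m)) (proj₂ (info m)) e)))
    (λ {z} {z'} {w} _ _ w1 w2 → djz z z' w w1 w2)
    where
    djz : ∀ z z' w → w ∈ map (λ i → insertAt i (suc n , z) σ) (upTo (suc n)) → w ∈ map (λ i → insertAt i (suc n , z') σ) (upTo (suc n)) → z ≡ z'
    djz z z' w w1 w2 with ∈-map⁻ (λ i → insertAt i (suc n , z) σ) {xs = upTo (suc n)} w1 | ∈-map⁻ (λ i → insertAt i (suc n , z') σ) {xs = upTo (suc n)} w2
    ... | i , i∈ , refl | i' , i'∈ , e = proj₁ (proj₂ (insertAt-injective (suc n) z z' i i' σ σ
          (subst (i ≤_) (sym (proj₁ (info m))) (≤-pred (∈-upTo⁻ i∈)))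
          (subst (i' ≤_) (sym (proj₁ (info m))) (≤-pred (∈-upTo⁻ i'∈)))
          (proj₂ (info m)) (proj₂ (info m)) e))
  dj : ∀ {σ σ' w} → σ ∈ coloredPerms r n → σ' ∈ coloredPerms r n → w ∈ insertions r n σ → w ∈ insertions r n σ' → σ ≡ σ'
  dj {σ} {σ'} {w} m m' w1 w2 with ∈-insertions⁻ {r} {n} {σ} w1 | ∈-insertions⁻ {r} {n} {σ'} w2
  ... | z , i , _ , i< , refl | z' , i' , _ , i'< , e = proj₂ (proj₂ (insertAt-injective (suc n) z z' i i' σ σ'
          (subst (i ≤_) (sym (proj₁ (info m))) (≤-pred i<))
          (subst (i' ≤_) (sym (proj₁ (info m'))) (≤-pred i'<))
          (proj₂ (info m)) (proj₂ (info m')) e))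

colorSum : List Letter → ℕ
colorSum π = sum (map proj₂ π)

colorSum-insertAt : ∀ i a z σ → colorSum (insertAt i (a , z) σ) ≡ z + colorSum σ
colorSum-insertAt zero a z σ = refl
colorSum-insertAt (suc i) a z [] = refl
colorSum-insertAt (suc i) a z ((b , w) ∷ σ) = trans (cong (w +_) (colorSum-insertAt i a z σ)) (l w z (colorSum σ))
  where l : ∀ a b c → a + (b + c) ≡ b + (a + c)
        l = solve-∀

pow-fmaj : ∀ r q π → q ^ fmaj r π ≡ (q ^ r) ^ majAfter (0 , 0) π * q ^ colorSum π
pow-fmaj r q π = trans (^-distribˡ-+-* q (r * majAfter (0 , 0) π) (colorSum π)) (cong (_* q ^ colorSum π) (sym (^-*-assoc q r _)))

T⇒≡true : ∀ {b} → T b → b ≡ true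
T⇒≡true {true} _ = refl

¬T⇒≡false : ∀ {b} → (T b → ⊥) → b ≡ false
¬T⇒≡false {true} f = ⊥-elim (f tt)
¬T⇒≡false {false} _ = refl

<ᵇ-suc-true : ∀ {a n} → a ≤ n → (a <ᵇ suc n) ≡ true
<ᵇ-suc-true a≤n = T⇒≡true (<⇒<ᵇ (s≤s a≤n))

suc-<ᵇ-false : ∀ {a n} → a ≤ n → (suc n <ᵇ a) ≡ false
suc-<ᵇ-false {a} {n} a≤n = ¬T⇒≡false (λ t → <⇒≱ (<ᵇ⇒< (suc n) a t) (m≤n⇒m≤1+n a≤n))

suc-≡ᵇ-false : ∀ {a n} → a ≤ n → (suc n ≡ᵇ a) ≡ false
suc-≡ᵇ-false {a} {n} a≤n = ¬T⇒≡false (λ t → <⇒≱ (s≤s a≤n) (≤-reflexive (≡ᵇ⇒≡ (suc n) a t)))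

maxLetter-order : ∀ n (u : Letter) → proj₁ u ≤ n → ((suc n , 0) >L u ≡ true) × (u >L (suc n , 0) ≡ false)
maxLetter-order n (a , zero) le = <ᵇ-suc-true le , suc-<ᵇ-false le
maxLetter-order n (a , suc w) le = refl , refl

coloredMaxLetter-order : ∀ n z (u : Letter) → proj₁ u ≤ n → ((suc n , suc z) >L u ≡ false) × (u >L (suc n , suc z) ≡ true)
coloredMaxLetter-order n z (a , zero) le = refl , refl
coloredMaxLetter-order n z (a , suc w) le rewrite suc-<ᵇ-false le | suc-≡ᵇ-false {a} {n} le | <ᵇ-suc-true le = refl , refl

letters≤ : ∀ {r n} (σ : List Letter) → All (ValidLetter r n) σ → All (λ u → proj₁ u ≤ n) ((0 , 0) ∷ σ)
letters≤ σ a = z≤n ∷ All.map (λ v → proj₂ (proj₁ v)) a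

colorWeight : ℕ → ℕ → ℕ
colorWeight q r' = Σ< r' (λ z → q ^ suc z)

Σ<-colorWeight : ∀ q c G r' → Σ< r' (λ z → q ^ (suc z + c) * G) ≡ q ^ c * G * colorWeight q r'
Σ<-colorWeight q c G r' = begin
  Σ< r' (λ z → q ^ (suc z + c) * G)
    ≡⟨ Σ<-cong r' (λ z → trans (cong (_* G) (^-distribˡ-+-* q (suc z) c)) (l (q ^ suc z) (q ^ c) G)) ⟩
  Σ< r' (λ z → q ^ c * G * q ^ suc z) ≡⟨ Σ<-*ˡ r' (q ^ c * G) (λ z → q ^ suc z) ⟩
  q ^ c * G * colorWeight q r' ∎
  where l : ∀ a b c → a * b * c ≡ b * c * a
        l = solve-∀

weightedSum : ℕ → ℕ → ℕ → ℕ → ℕ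
weightedSum r q n K = sum (map (λ π → q ^ fmaj r π * weight (q ^ r) n K (des π)) (coloredPerms r n))

-- The total weight in weightedSum r q (suc n) K of all insertions of n+1 into a σ with d descents, divided by
-- q^{fmaj σ}; the colors 1, ..., r-1 contribute the factor s = colorWeight.
insertionWeight : ℕ → ℕ → ℕ → ℕ → ℕ → ℕ
insertionWeight Q s n K d = (qint Q (suc d) + s * qint Q d) * weight Q (suc n) K d
     + (Q ^ suc d * qint Q (n ∸ d) + s * (Q ^ d * qint Q (suc (n ∸ d)))) * weight Q (suc n) K (suc d)

insertions-Σ : ∀ (g : List Letter → ℕ) r n σ →
  sum (map g (insertions r n σ)) ≡ Σ< r (λ z → Σ< (suc n) (λ i → g (insertAt i (suc n , z) σ)))
insertions-Σ g r n σ = begin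
  sum (map g (insertions r n σ))
    ≡⟨ sum-map-concatMap g (λ z → map (h z) (upTo (suc n))) (upTo r) ⟩
  sum (map (λ z → sum (map g (map (h z) (upTo (suc n))))) (upTo r))
    ≡⟨ sum-upTo _ r ⟩
  Σ< r (λ z → sum (map g (map (h z) (upTo (suc n)))))
    ≡⟨ Σ<-cong r (λ z → trans (cong sum (sym (map-∘ (upTo (suc n))))) (sum-upTo (g ∘ h z) (suc n))) ⟩
  Σ< r (λ z → Σ< (suc n) (λ i → g (h z i))) ∎
  where
  h = λ z i → insertAt i (suc n , z) σ

sum-insertions : ∀ r' q n K σ → σ ∈ coloredPerms (suc r') n →
  sum (map (λ π → q ^ fmaj (suc r') π * weight (q ^ suc r') (suc n) K (des π)) (insertions (suc r') n σ))
  ≡ q ^ fmaj (suc r') σ * insertionWeight (q ^ suc r') (colorWeight q r') n K (des σ)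
sum-insertions r' q n K σ σ∈ = begin
  sum (map g (insertions r n σ))
    ≡⟨ insertions-Σ g r n σ ⟩
  Σ< r (λ z → Σ< (suc n) (λ i → g (h z i)))
    ≡⟨ Σ<-cong r (λ z → trans (Σ<-cong (suc n) (λ i → gins z i)) (Σ<-*ˡ (suc n) (q ^ (z + colorSum σ)) (λ i → Q ^ majAfter (0 , 0) (h z i) * f (desAfter (0 , 0) (h z i))))) ⟩
  Σ< r (λ z → q ^ (z + colorSum σ) * Σ< (suc n) (λ i → Q ^ majAfter (0 , 0) (h z i) * f (desAfter (0 , 0) (h z i))))
    ≡⟨ Σ<-cong r (λ z → cong (λ t → q ^ (z + colorSum σ) * Σ< (suc t) (λ i → Q ^ majAfter (0 , 0) (h z i) * f (desAfter (0 , 0) (h z i)))) (sym len)) ⟩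
  Σ< r (λ z → q ^ (z + colorSum σ) * insertionSum Q f (suc n , z) (0 , 0) σ)
    ≡⟨ cong₂ _+_ (cong (q ^ colorSum σ *_) (insertionSum-max Q f (suc n , 0) (0 , 0) σ (All.map (λ {u} le → maxLetter-order n u le) (letters≤ σ al))))
                 (trans (Σ<-cong r' (λ z → cong (q ^ (suc z + colorSum σ) *_) (insertionSum-min Q f (suc n , suc z) (0 , 0) σ (All.map (λ {u} le → coloredMaxLetter-order n z u le) (letters≤ σ al)))))
                        (Σ<-colorWeight q (colorSum σ) _ r')) ⟩
  q ^ colorSum σ * (Y * (qint Q (suc d) * f d + Q ^ suc d * qint Q (length σ ∸ d) * f (suc d)))
  + q ^ colorSum σ * (Y * (qint Q d * f d + Q ^ d * qint Q (suc (length σ) ∸ d) * f (suc d))) * s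
    ≡⟨ cong₂ (λ u v → q ^ colorSum σ * (Y * (qint Q (suc d) * f d + Q ^ suc d * qint Q (u ∸ d) * f (suc d)))
                 + q ^ colorSum σ * (Y * (qint Q d * f d + Q ^ d * qint Q v * f (suc d))) * s) len
               (trans (cong (λ t → suc t ∸ d) len) (suc∸ d≤n)) ⟩
  q ^ colorSum σ * (Y * (qint Q (suc d) * f d + Q ^ suc d * qint Q (n ∸ d) * f (suc d)))
  + q ^ colorSum σ * (Y * (qint Q d * f d + Q ^ d * qint Q (suc (n ∸ d)) * f (suc d))) * s
    ≡⟨ l (q ^ colorSum σ) Y (qint Q (suc d)) (qint Q d) (f d) (f (suc d)) (Q ^ suc d) (Q ^ d) (qint Q (n ∸ d)) (qint Q (suc (n ∸ d))) s ⟩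
  Y * q ^ colorSum σ * ((qint Q (suc d) + s * qint Q d) * f d + (Q ^ suc d * qint Q (n ∸ d) + s * (Q ^ d * qint Q (suc (n ∸ d)))) * f (suc d))
    ≡⟨ cong (_* ((qint Q (suc d) + s * qint Q d) * f d + (Q ^ suc d * qint Q (n ∸ d) + s * (Q ^ d * qint Q (suc (n ∸ d)))) * f (suc d))) (sym (pow-fmaj r q σ)) ⟩
  q ^ fmaj r σ * ((qint Q (suc d) + s * qint Q d) * f d + (Q ^ suc d * qint Q (n ∸ d) + s * (Q ^ d * qint Q (suc (n ∸ d)))) * f (suc d)) ∎
  where
  r = suc r'
  Q = q ^ r
  s = colorWeight q r'
  f = weight Q (suc n) K
  g = λ π → q ^ fmaj r π * weight Q (suc n) K (des π)
  h = λ z i → insertAt i (suc n , z) σ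
  d = des σ
  Y = Q ^ majAfter (0 , 0) σ
  vp = ∈-coloredPerms⁻ {r} {n} σ∈
  len : length σ ≡ n
  len = proj₁ vp
  al = proj₁ (proj₂ vp)
  d≤n : d ≤ n
  d≤n = subst (d ≤_) len (desAfter≤length (0 , 0) σ)
  gins : ∀ z i → g (h z i) ≡ q ^ (z + colorSum σ) * (Q ^ majAfter (0 , 0) (h z i) * f (desAfter (0 , 0) (h z i)))
  gins z i = trans (cong (_* f (desAfter (0 , 0) (h z i))) (trans (pow-fmaj r q (h z i)) (cong (λ t → Q ^ majAfter (0 , 0) (h z i) * q ^ t) (colorSum-insertAt i (suc n) z σ))))
                   (l2 (Q ^ majAfter (0 , 0) (h z i)) (q ^ (z + colorSum σ)) (f (desAfter (0 , 0) (h z i))))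
    where l2 : ∀ a b c → a * b * c ≡ b * (a * c)
          l2 = solve-∀
  l : ∀ X Y a1 a0 F0 F1 P1 P0 M M1 s →
      X * (Y * (a1 * F0 + P1 * M * F1)) + X * (Y * (a0 * F0 + P0 * M1 * F1)) * s
      ≡ Y * X * ((a1 + s * a0) * F0 + (P1 * M + s * (P0 * M1)) * F1)
  l = solve-∀

weightedSum-suc : ∀ r' q n K → weightedSum (suc r') q (suc n) K
  ≡ sum (map (λ σ → q ^ fmaj (suc r') σ * insertionWeight (q ^ suc r') (colorWeight q r') n K (des σ)) (coloredPerms (suc r') n))
weightedSum-suc r' q n K = begin
  sum (map g (coloredPerms r (suc n)))
    ≡⟨ sum-map-bag g (coloredPerms r (suc n)) (allInsertions r n) (Unique-coloredPerms r (suc n)) (Unique-allInsertions r n)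
         (λ m → ∈-allInsertions⁺ {r} {n} (∈-coloredPerms⁻ {r} {suc n} m)) (λ m → ∈-coloredPerms⁺ {r} {suc n} (∈-allInsertions⁻ {r} {n} m)) ⟩
  sum (map g (allInsertions r n)) ≡⟨ sum-map-concatMap g (insertions r n) (coloredPerms r n) ⟩
  sum (map (λ σ → sum (map g (insertions r n σ))) (coloredPerms r n))
    ≡⟨ sum-map-cong _ _ (coloredPerms r n) (λ {σ} m → sum-insertions r' q n K σ m) ⟩
  sum (map (λ σ → q ^ fmaj r σ * insertionWeight (q ^ r) (colorWeight q r') n K (des σ)) (coloredPerms r n)) ∎
  where
  r = suc r'
  g = λ π → q ^ fmaj r π * weight (q ^ r) (suc n) K (des π)

insertionWeight-offset : ∀ Q s d N K → insertionWeight Q s (d + N) K d ≡ (qint Q (suc d) + s * qint Q d) * weight Q (suc (d + N)) K d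
     + (Q ^ suc d * qint Q N + s * (Q ^ d * qint Q (suc N))) * weight Q (suc (d + N)) K (suc d)
insertionWeight-offset Q s d N K = cong (λ u → (qint Q (suc d) + s * qint Q d) * weight Q (suc (d + N)) K d
     + (Q ^ suc d * qint Q u + s * (Q ^ d * qint Q (suc u))) * weight Q (suc (d + N)) K (suc d)) (m+n∸m≡n d N)

insertionWeight-suc : ∀ Q s d n K → d ≤ n → insertionWeight Q s n (suc K) d
  ≡ Q ^ K * (s + Q) * qint Q (suc K) * weight Q n K d + (qint Q (suc (suc K)) + s * qint Q (suc K)) * weight Q n (suc K) d
insertionWeight-suc Q s d n K d≤n with m≤n⇒∃[o]m+o≡n d≤n
... | N , refl = trans (insertionWeight-offset Q s d N (suc K)) (weight-recurrence Q s d N K)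

insertionWeight-zero : ∀ Q s d n → d ≤ n → insertionWeight Q s n 0 d ≡ weight Q n 0 d
insertionWeight-zero Q s d n d≤n with m≤n⇒∃[o]m+o≡n d≤n
... | N , refl = trans (insertionWeight-offset Q s d N 0) (weight-recurrence-zero Q s d N)

des≤n : ∀ {r n σ} → σ ∈ coloredPerms r n → des σ ≤ n
des≤n {r} {n} {σ} m = subst (des σ ≤_) (proj₁ (∈-coloredPerms⁻ {r} {n} m)) (desAfter≤length (0 , 0) σ)

weightedSum-suc-zero : ∀ r' q n → weightedSum (suc r') q (suc n) 0 ≡ weightedSum (suc r') q n 0
weightedSum-suc-zero r' q n = trans (weightedSum-suc r' q n 0) (sum-map-cong _ _ (coloredPerms (suc r') n)
  (λ {σ} m → cong (q ^ fmaj (suc r') σ *_) (insertionWeight-zero (q ^ suc r') (colorWeight q r') (des σ) n (des≤n {suc r'} {n} m))))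

weightedSum-suc-suc : ∀ r' q n K → weightedSum (suc r') q (suc n) (suc K) ≡
  (q ^ suc r') ^ K * (colorWeight q r' + q ^ suc r') * qint (q ^ suc r') (suc K) * weightedSum (suc r') q n K
  + (qint (q ^ suc r') (suc (suc K)) + colorWeight q r' * qint (q ^ suc r') (suc K)) * weightedSum (suc r') q n (suc K)
weightedSum-suc-suc r' q n K = trans (weightedSum-suc r' q n (suc K)) (trans (sum-map-cong _ _ (coloredPerms (suc r') n)
  (λ {σ} m → cong (q ^ fmaj (suc r') σ *_) (insertionWeight-suc (q ^ suc r') (colorWeight q r') (des σ) n K (des≤n {suc r'} {n} m))))
  (sum-map-linear (λ σ → q ^ fmaj (suc r') σ) (λ σ → weight (q ^ suc r') n K (des σ)) (λ σ → weight (q ^ suc r') n (suc K) (des σ))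
    ((q ^ suc r') ^ K * (colorWeight q r' + q ^ suc r') * qint (q ^ suc r') (suc K)) (qint (q ^ suc r') (suc (suc K)) + colorWeight q r' * qint (q ^ suc r') (suc K)) (coloredPerms (suc r') n)))

lhsFactor : ℕ → ℕ → ℕ → ℕ
lhsFactor r q k = q ^ ((r * (suc k C 2) + k) ∸ r * k) * qint q r ^ k * qfact (q ^ r) k

sucC2 : ∀ k → suc k C 2 ≡ k + k C 2
sucC2 k = trans (sym (nCk+nC[k+1]≡[n+1]C[k+1] k 1)) (cong (_+ k C 2) (nC1≡n k))

lhsFactor-exponent : ∀ r k → (r * (suc k C 2) + k) ∸ r * k ≡ r * (k C 2) + k
lhsFactor-exponent r k = begin
  (r * (suc k C 2) + k) ∸ r * k ≡⟨ cong (λ t → (r * t + k) ∸ r * k) (sucC2 k) ⟩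
  (r * (k + k C 2) + k) ∸ r * k ≡⟨ cong (_∸ r * k) (l r k (k C 2)) ⟩
  (r * k + (r * (k C 2) + k)) ∸ r * k ≡⟨ m+n∸m≡n (r * k) _ ⟩
  r * (k C 2) + k ∎
  where l : ∀ r k c → r * (k + c) + k ≡ r * k + (r * c + k)
        l = solve-∀

colorWeight≡q*qint : ∀ q r' → colorWeight q r' ≡ q * qint q r'
colorWeight≡q*qint q r' = trans (Σ<-*ˡ r' q (q ^_)) (cong (q *_) (sym (qint-Σ q r')))

q*qint-suc : ∀ q r' → q * qint q (suc r') ≡ colorWeight q r' + q ^ suc r'
q*qint-suc q r' = trans (cong (q *_) (qint-sucʳ q r')) (trans (*-distribˡ-+ q (qint q r') (q ^ r')) (cong (_+ q ^ suc r') (sym (colorWeight≡q*qint q r'))))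

qint-r*K+1 : ∀ q r' K → qint q (suc r' * K + 1) ≡ qint (q ^ suc r') (suc K) + colorWeight q r' * qint (q ^ suc r') K
qint-r*K+1 q r' K = begin
  qint q (r * K + 1) ≡⟨ qint-+ q (r * K) 1 ⟩
  qint q (r * K) + q ^ (r * K) * 1 ≡⟨ cong₂ (λ u v → u + v * 1) (qint-* q r K) (sym (^-*-assoc q r K)) ⟩
  qint q r * qint Q K + Q ^ K * 1 ≡⟨ cong (λ u → u * qint Q K + Q ^ K * 1) (trans (qint-suc q r') (cong (1 +_) (sym (colorWeight≡q*qint q r')))) ⟩
  (1 + s) * qint Q K + Q ^ K * 1 ≡⟨ l s (qint Q K) (Q ^ K) ⟩
  (qint Q K + Q ^ K) + s * qint Q K ≡⟨ cong (_+ s * qint Q K) (sym (qint-sucʳ Q K)) ⟩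
  qint Q (suc K) + s * qint Q K ∎
  where
  r = suc r'
  Q = q ^ r
  s = colorWeight q r'
  l : ∀ s a b → (1 + s) * a + b * 1 ≡ (a + b) + s * a
  l = solve-∀

lhsFactor-suc : ∀ q r' k → lhsFactor (suc r') q (suc k) ≡ (q ^ suc r') ^ k * (colorWeight q r' + q ^ suc r') * qint (q ^ suc r') (suc k) * lhsFactor (suc r') q k
lhsFactor-suc q r' k = begin
  q ^ ((r * (suc (suc k) C 2) + suc k) ∸ r * suc k) * qint q r ^ suc k * qfact Q (suc k)
    ≡⟨ cong (λ t → q ^ t * qint q r ^ suc k * qfact Q (suc k)) (lhsFactor-exponent r (suc k)) ⟩
  q ^ (r * (suc k C 2) + suc k) * qint q r ^ suc k * qfact Q (suc k)
    ≡⟨ cong (λ t → q ^ t * qint q r ^ suc k * qfact Q (suc k)) (trans (cong (λ t → r * t + suc k) (sucC2 k)) (l1 r k (k C 2))) ⟩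
  q ^ ((r * (k C 2) + k) + (r * k + 1)) * qint q r ^ suc k * qfact Q (suc k)
    ≡⟨ cong (λ t → t * qint q r ^ suc k * qfact Q (suc k))
         (trans (^-distribˡ-+-* q (r * (k C 2) + k) (r * k + 1))
                (cong (q ^ (r * (k C 2) + k) *_) (trans (^-distribˡ-+-* q (r * k) 1) (cong (_* q ^ 1) (sym (^-*-assoc q r k)))))) ⟩
  q ^ (r * (k C 2) + k) * (Q ^ k * q ^ 1) * (qint q r * qint q r ^ k) * (qfact Q k * qint Q (suc k))
    ≡⟨ l2 (q ^ (r * (k C 2) + k)) (Q ^ k) q (qint q r) (qint q r ^ k) (qfact Q k) (qint Q (suc k)) ⟩
  Q ^ k * (q * qint q r) * qint Q (suc k) * (q ^ (r * (k C 2) + k) * qint q r ^ k * qfact Q k)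
    ≡⟨ cong₂ (λ u v → Q ^ k * u * qint Q (suc k) * (q ^ v * qint q r ^ k * qfact Q k)) (q*qint-suc q r') (sym (lhsFactor-exponent r k)) ⟩
  Q ^ k * (colorWeight q r' + Q) * qint Q (suc k) * lhsFactor r q k ∎
  where
  r = suc r'
  Q = q ^ r
  l1 : ∀ r k c → r * (k + c) + suc k ≡ (r * c + k) + (r * k + 1)
  l1 = solve-∀
  l2 : ∀ E Qk q a ak F g → E * (Qk * (q * 1)) * (a * ak) * (F * g) ≡ Qk * (q * a) * g * (E * ak * F)
  l2 = solve-∀

lhsFactor-zero : ∀ r q → lhsFactor r q 0 ≡ 1
lhsFactor-zero r q = trans (cong (λ t → q ^ t * 1 * 1) (trans (lhsFactor-exponent r 0) (cong (_+ 0) (*-zeroʳ r)))) refl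

fmaj-[] : ∀ r → fmaj r [] ≡ 0
fmaj-[] r = trans (+-identityʳ (r * 0)) (*-zeroʳ r)

weightedSum≡lhsFactor*S : ∀ r' q n k → weightedSum (suc r') q n k ≡ lhsFactor (suc r') q k * S (suc r') q n k
weightedSum≡lhsFactor*S r' q zero zero = begin
  q ^ fmaj (suc r') [] * weight (q ^ suc r') 0 0 0 + 0
    ≡⟨ cong₂ (λ u v → q ^ u * v + 0) (fmaj-[] (suc r')) (weight-diag (q ^ suc r') 0 0) ⟩
  1 ≡⟨ sym (cong (_* 1) (lhsFactor-zero (suc r') q)) ⟩
  lhsFactor (suc r') q 0 * 1 ∎
weightedSum≡lhsFactor*S r' q zero (suc k) = begin
  q ^ fmaj (suc r') [] * weight (q ^ suc r') 0 (suc k) 0 + 0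
    ≡⟨ cong (λ v → q ^ fmaj (suc r') [] * v + 0) (weight-k>n (q ^ suc r') 0 (suc k) 0 z≤n (s≤s z≤n)) ⟩
  q ^ fmaj (suc r') [] * 0 + 0 ≡⟨ cong (_+ 0) (*-zeroʳ (q ^ fmaj (suc r') [])) ⟩
  0 ≡⟨ sym (*-zeroʳ (lhsFactor (suc r') q (suc k))) ⟩
  lhsFactor (suc r') q (suc k) * 0 ∎
weightedSum≡lhsFactor*S r' q (suc n) zero = begin
  weightedSum (suc r') q (suc n) 0 ≡⟨ weightedSum-suc-zero r' q n ⟩
  weightedSum (suc r') q n 0 ≡⟨ weightedSum≡lhsFactor*S r' q n 0 ⟩
  lhsFactor (suc r') q 0 * S (suc r') q n 0
    ≡⟨ cong (lhsFactor (suc r') q 0 *_) (sym (trans (cong (λ t → qint q (t + 1) * S (suc r') q n 0) (*-zeroʳ (suc r'))) (+-identityʳ _))) ⟩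
  lhsFactor (suc r') q 0 * S (suc r') q (suc n) 0 ∎
weightedSum≡lhsFactor*S r' q (suc n) (suc k) = begin
  weightedSum (suc r') q (suc n) (suc k) ≡⟨ weightedSum-suc-suc r' q n k ⟩
  C1 * weightedSum (suc r') q n k + C2 * weightedSum (suc r') q n (suc k)
    ≡⟨ cong₂ (λ u v → C1 * u + C2 * v) (weightedSum≡lhsFactor*S r' q n k) (weightedSum≡lhsFactor*S r' q n (suc k)) ⟩
  C1 * (lhsFactor (suc r') q k * S (suc r') q n k) + C2 * (lhsFactor (suc r') q (suc k) * S (suc r') q n (suc k))
    ≡⟨ cong (_+ C2 * (lhsFactor (suc r') q (suc k) * S (suc r') q n (suc k))) (sym (*-assoc C1 (lhsFactor (suc r') q k) (S (suc r') q n k))) ⟩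
  C1 * lhsFactor (suc r') q k * S (suc r') q n k + C2 * (lhsFactor (suc r') q (suc k) * S (suc r') q n (suc k))
    ≡⟨ cong₂ (λ u v → u * S (suc r') q n k + v * (lhsFactor (suc r') q (suc k) * S (suc r') q n (suc k)))
         (sym (lhsFactor-suc q r' k)) (sym (qint-r*K+1 q r' (suc k))) ⟩
  lhsFactor (suc r') q (suc k) * S (suc r') q n k + qint q (suc r' * suc k + 1) * (lhsFactor (suc r') q (suc k) * S (suc r') q n (suc k))
    ≡⟨ l (lhsFactor (suc r') q (suc k)) (S (suc r') q n k) (qint q (suc r' * suc k + 1)) (S (suc r') q n (suc k)) ⟩
  lhsFactor (suc r') q (suc k) * (S (suc r') q n k + qint q (suc r' * suc k + 1) * S (suc r') q n (suc k)) ∎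
  where
  C1 = (q ^ suc r') ^ k * (colorWeight q r' + q ^ suc r') * qint (q ^ suc r') (suc k)
  C2 = qint (q ^ suc r') (suc (suc k)) + colorWeight q r' * qint (q ^ suc r') (suc k)
  l : ∀ c a b e → c * a + b * (c * e) ≡ c * (a + b * e)
  l = solve-∀

Σ<-select : ∀ m d (h : ℕ → ℕ) → d < m → Σ< m (λ ℓ → if does (d ≟ ℓ) then h ℓ else 0) ≡ h d
Σ<-select (suc m) zero h _ = trans (cong (h 0 +_) (pz m)) (+-identityʳ (h 0))
  where pz : ∀ m → Σ< m (λ _ → 0) ≡ 0
        pz zero = refl
        pz (suc m) = pz m
Σ<-select (suc m) (suc d) h (s≤s d<m) = Σ<-select m d (λ ℓ → h (suc ℓ)) d<m

Σ<-select-none : ∀ m d (h : ℕ → ℕ) → m ≤ d → Σ< m (λ ℓ → if does (d ≟ ℓ) then h ℓ else 0) ≡ 0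
Σ<-select-none zero d h _ = refl
Σ<-select-none (suc m) (suc d) h (s≤s m≤d) = Σ<-select-none m d (λ ℓ → h (suc ℓ)) m≤d

*-if-* : ∀ (b : Bool) c x e → c * (if b then x else 0) * e ≡ (if b then c * x * e else 0)
*-if-* true c x e = refl
*-if-* false c x e = trans (cong (_* e) (*-zeroʳ c)) refl

Σ0to-select : ∀ r q n k d x → d ≤ n → k ≤ n →
  Σ0to k (λ ℓ → q ^ (r * k * (k ∸ ℓ)) * (if does (d ≟ ℓ) then x else 0) * qbinom (q ^ r) (n ∸ ℓ) (k ∸ ℓ))
  ≡ x * weight (q ^ r) n k d
Σ0to-select r q n k d x d≤n k≤n = begin
  Σ0to k (λ ℓ → q ^ (r * k * (k ∸ ℓ)) * (if does (d ≟ ℓ) then x else 0) * qbinom (q ^ r) (n ∸ ℓ) (k ∸ ℓ))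
    ≡⟨ sum-upTo _ (suc k) ⟩
  Σ< (suc k) (λ ℓ → q ^ (r * k * (k ∸ ℓ)) * (if does (d ≟ ℓ) then x else 0) * qbinom (q ^ r) (n ∸ ℓ) (k ∸ ℓ))
    ≡⟨ Σ<-cong (suc k) (λ ℓ → *-if-* (does (d ≟ ℓ)) (q ^ (r * k * (k ∸ ℓ))) x (qbinom (q ^ r) (n ∸ ℓ) (k ∸ ℓ))) ⟩
  Σ< (suc k) (λ ℓ → if does (d ≟ ℓ) then h ℓ else 0) ≡⟨ fin ⟩
  x * weight (q ^ r) n k d ∎
  where
  h = λ ℓ → q ^ (r * k * (k ∸ ℓ)) * x * qbinom (q ^ r) (n ∸ ℓ) (k ∸ ℓ)
  fin : Σ< (suc k) (λ ℓ → if does (d ≟ ℓ) then h ℓ else 0) ≡ x * weight (q ^ r) n k d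
  fin with d ≤? k
  ... | yes d≤k = begin
        Σ< (suc k) (λ ℓ → if does (d ≟ ℓ) then h ℓ else 0) ≡⟨ Σ<-select (suc k) d h (s≤s d≤k) ⟩
        q ^ (r * k * (k ∸ d)) * x * qbinom (q ^ r) (n ∸ d) (k ∸ d)
          ≡⟨ cong₂ (λ u v → u * x * v) (trans (cong (q ^_) (*-assoc r k (k ∸ d))) (sym (^-*-assoc q r (k * (k ∸ d)))))
                (qbinom≡qchoose (q ^ r) (n ∸ d) (k ∸ d) (∸-monoˡ-≤ d k≤n)) ⟩
        (q ^ r) ^ (k * (k ∸ d)) * x * qchoose (q ^ r) (n ∸ d) (k ∸ d)
          ≡⟨ l ((q ^ r) ^ (k * (k ∸ d))) x (qchoose (q ^ r) (n ∸ d) (k ∸ d)) ⟩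
        x * ((q ^ r) ^ (k * (k ∸ d)) * qchoose (q ^ r) (n ∸ d) (k ∸ d)) ≡⟨ cong (x *_) (sym (weight-≤ (q ^ r) n k d d≤k)) ⟩
        x * weight (q ^ r) n k d ∎
    where l : ∀ a b c → a * b * c ≡ b * (a * c)
          l = solve-∀
  ... | no d≰k = trans (Σ<-select-none (suc k) d h (≰⇒> d≰k)) (sym (trans (cong (x *_) (weight-d>k (q ^ r) n k d (≰⇒> d≰k))) (*-zeroʳ x)))

rhs≡weightedSum : ∀ r q n k → k ≤ n →
  Σ0to k (λ ℓ → q ^ (r * k * (k ∸ ℓ)) * A r n ℓ q * qbinom (q ^ r) (n ∸ ℓ) (k ∸ ℓ)) ≡ weightedSum r q n k
rhs≡weightedSum r q n k k≤n = begin
  sum (map (λ ℓ → q ^ (r * k * (k ∸ ℓ)) * A r n ℓ q * qbinom (q ^ r) (n ∸ ℓ) (k ∸ ℓ)) (upTo (suc k)))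
    ≡⟨ sum-map-cong _ _ (upTo (suc k)) (λ {ℓ} _ → trans (cong (λ t → q ^ (r * k * (k ∸ ℓ)) * t * qbinom (q ^ r) (n ∸ ℓ) (k ∸ ℓ))
             (sum-map-filter (λ π → des π ≟ ℓ) (λ π → q ^ fmaj r π) (coloredPerms r n)))
           (sum-map-* (q ^ (r * k * (k ∸ ℓ))) (qbinom (q ^ r) (n ∸ ℓ) (k ∸ ℓ)) _ (coloredPerms r n))) ⟩
  sum (map (λ ℓ → sum (map (G ℓ) (coloredPerms r n))) (upTo (suc k)))
    ≡⟨ sum-map-swap G (upTo (suc k)) (coloredPerms r n) ⟩
  sum (map (λ π → Σ0to k (λ ℓ → G ℓ π)) (coloredPerms r n))
    ≡⟨ sum-map-cong _ _ (coloredPerms r n) (λ {π} m → Σ0to-select r q n k (des π) (q ^ fmaj r π) (des≤n {r} {n} m) k≤n) ⟩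
  weightedSum r q n k ∎
  where
  G = λ ℓ π → q ^ (r * k * (k ∸ ℓ)) * (if does (des π ≟ ℓ) then q ^ fmaj r π else 0) * qbinom (q ^ r) (n ∸ ℓ) (k ∸ ℓ)

theorem4p2 : (r : ℕ) → 1 ≤ r → (n k : ℕ) → k ≤ n → (q : ℕ) →
    q ^ ((r * (suc k C 2) + k) ∸ r * k) * qint q r ^ k * qfact (q ^ r) k * S r q n k
      ≡ Σ0to k (λ ℓ → q ^ (r * k * (k ∸ ℓ)) * A r n ℓ q * qbinom (q ^ r) (n ∸ ℓ) (k ∸ ℓ))
theorem4p2 (suc r') _ n k k≤n q = begin
  lhsFactor (suc r') q k * S (suc r') q n k  ≡⟨ weightedSum≡lhsFactor*S r' q n k ⟨
  weightedSum (suc r') q n k                 ≡⟨ rhs≡weightedSum (suc r') q n k k≤n ⟨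
  Σ0to k (λ ℓ → q ^ (suc r' * k * (k ∸ ℓ)) * A (suc r') n ℓ q * qbinom (q ^ suc r') (n ∸ ℓ) (k ∸ ℓ)) ∎
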